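{- For all $k\geq2$, $$\mathcal{D}_{213\dots k}(x)=G_{k-1}(x)+xG_{k-2}(x).$$
   Context: A permutation $\pi$ is a Dumont permutation (of the first kind) if each even integer in $\pi$ is followed by a smaller integer, and each odd integer is either followed by a larger integer or is the last element of $\pi$. For a pattern $\tau$, $\mathcal{D}_\tau(x)=\sum_{n\geq0}\mathcal{D}_\tau(n)x^n$ where $\mathcal{D}_\tau(n)$ is the number of Dumont permutations of length $n$ avoiding both $132$ and $\tau$ (classical pattern avoidance). For $r\geq2$ consider $Q_r(x)=1+\frac{x^2Q_{r-1}(x)}{1-x^2Q_{r-2}(x)}$; $G_r(x)$ denotes its solution with $Q_0(x)=Q_1(x)=1$ (e.g. $G_2=\frac{1}{1-x^2}$). Here $213\dots k$ is the pattern $2134\cdots k$. -}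

module Defs where

open import Data.Nat using (ℕ; zero; suc; _+_; _*_; _∸_; _<ᵇ_; _≡ᵇ_)
open import Data.Nat.Base using (_%_)
open import Data.Bool using (Bool; true; false; _∧_; _∨_; not; if_then_else_)
open import Data.List using (List; []; _∷_; map; concatMap; filter; length; upTo; zip)
open import Data.Bool.ListAction using (all; any)
open import Data.Product using (_,_)
open import Relation.Nullary.Decidable using (does)
open import Data.Bool using (T)
open import Data.Bool.Properties using (T?)

-- Permutations of length n: lists of length n with entries in {1..n},
-- pairwise distinct.

words : ℕ → ℕ → List (List ℕ)
words n zero    = [] ∷ []
words n (suc m) = concatMap (λ w → map (λ i → suc i ∷ w) (upTo n)) (words n m)

notElem : ℕ → List ℕ → Bool
notElem a l = all (λ b → not (a ≡ᵇ b)) l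

distinct : List ℕ → Bool
distinct []      = true
distinct (a ∷ l) = notElem a l ∧ distinct l

perms : ℕ → List (List ℕ)
perms n = filter (λ w → T? (distinct w)) (words n n)

-- Dumont permutations (first kind): each even entry is followed by a
-- smaller entry (so it is not last); each odd entry is followed by a
-- larger one or is last.

isEven : ℕ → Bool
isEven a = (a % 2) ≡ᵇ 0

dumont : List ℕ → Bool
dumont []            = true
dumont (a ∷ [])      = not (isEven a)
dumont (a ∷ b ∷ r)   = (if isEven a then b <ᵇ a else a <ᵇ b) ∧ dumont (b ∷ r)

subseqs : List ℕ → List (List ℕ)
subseqs []      = [] ∷ []
subseqs (a ∷ l) = map (a ∷_) (subseqs l) Data.List.++ subseqs l

-- order-isomorphism of two sequences (of distinct entries): same length
-- and for all positions i < j, u_i < u_j iff v_i < v_j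
orderIso : List ℕ → List ℕ → Bool
orderIso []      []      = true
orderIso (a ∷ u) (b ∷ v) =
  all (λ { (x , y) → does ((a <ᵇ x) Data.Bool.≟ (b <ᵇ y)) }) (zip u v) ∧ orderIso u v
orderIso _       _       = false

contains : List ℕ → List ℕ → Bool
contains π τ = any (orderIso τ) (subseqs π)

avoids : List ℕ → List ℕ → Bool
avoids π τ = not (contains π τ)

p132 : List ℕ
p132 = 1 ∷ 3 ∷ 2 ∷ []

p213k : ℕ → List ℕ
p213k k = 2 ∷ 1 ∷ map (λ i → i + 3) (upTo (k ∸ 2))

D : List ℕ → ℕ → ℕ
D τ n = length (filter (λ π → T? (dumont π ∧ avoids π p132 ∧ avoids π τ)) (perms n))

PS : Set
PS = ℕ → ℕ

sumTo : ℕ → (ℕ → ℕ) → ℕ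
sumTo zero    f = f 0
sumTo (suc n) f = sumTo n f + f (suc n)

one : PS
one zero    = 1
one (suc _) = 0

X : PS
X 1 = 1
X _ = 0

infixl 6 _⊕_
infixl 7 _⊛_

_⊕_ : PS → PS → PS
(f ⊕ g) n = f n + g n

_⊛_ : PS → PS → PS
(f ⊛ g) n = sumTo n (λ i → f i * g (n ∸ i))

pow : PS → ℕ → PS
pow B zero    = one
pow B (suc j) = B ⊛ pow B j

-- geom B = 1/(1 - B) = Σ_j B^j, valid when B has zero constant term
-- (then B^j contributes nothing to coefficients below j).
geom : PS → PS
geom B n = sumTo n (λ j → pow B j n)

-- G r = Q_r with Q_0 = Q_1 = 1 and
-- Q_r = 1 + x^2 Q_{r-1} / (1 - x^2 Q_{r-2})
G : ℕ → PS
G zero          = one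
G (suc zero)    = one
G (suc (suc r)) = one ⊕ (X ⊛ X ⊛ G (suc r)) ⊛ geom (X ⊛ X ⊛ G r)

-- The maximum M of a 132-avoiding permutation π splits it as α M β with every entry of α above
-- every entry of β, so α and β are permutations of adjacent intervals. Then π avoids 2 1 3 ⋯ k
-- iff α avoids 2 1 3 ⋯ (k - 1) and β avoids 2 1 3 ⋯ k, and π is Dumont iff α and β are, with M
-- odd exactly when β is empty. As the smallest entry of a nonempty α must be odd, β then has even
-- length. Enumerating along this decomposition, the counts satisfy
--   d_k(2t + 1) = d_(k-1)(2t),   d_k(2t + 2) = d_k(2t + 1) + Σ_(1 ≤ s ≤ t) d_(k-1)(2t + 1 - 2s) d_k(2s),
-- and so do the coefficients of G_(k-1) + x G_(k-2): all G_r are even series and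
-- G_(r+2) - 1 = x² G_(r+1) + x² G_r (G_(r+2) - 1).

module Submission where

open import Defs
open import Data.Nat using (ℕ; _≤_; _∸_)
open import Relation.Binary.PropositionalEquality using (_≡_)

open import Data.Nat using (zero; suc; _+_; _*_; _<_; _%_; _≡ᵇ_; _<ᵇ_; z≤n; s≤s; z<s; _≤?_; _<?_; _≟_)
open import Data.Nat.Properties
open import Data.Nat.DivMod using (%-distribˡ-+; m%n%n≡m%n; [m+n]%n≡m%n)
open import Data.Nat.Tactic.RingSolver using (solve-∀)
open import Data.Bool using (Bool; true; false; T; not; _∧_; if_then_else_)
import Data.Bool as Bool
open import Data.Bool.Properties using (T-∧; T-≡; T?; ∧-assoc)
open import Data.Bool.ListAction using (all)
open import Data.List
  using (List; []; _∷_; _++_; map; zip; filter; concatMap; length; upTo; applyUpTo; cartesianProductWith)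
open import Data.List.Properties
  using (length-++; length-++-sucʳ; length-map; length-upTo; map-upTo; ++-identityʳ;
         ∷ʳ-injectiveˡ; ∷-injective; ∷-injectiveʳ)
open import Data.List.Relation.Unary.All as All using (All; []; _∷_)
import Data.List.Relation.Unary.All.Properties as All
open import Data.List.Relation.Unary.AllPairs using (AllPairs; []; _∷_)
import Data.List.Relation.Unary.AllPairs.Properties as AllPairs
open import Data.List.Relation.Unary.Any using (here; there)
open import Data.List.Relation.Unary.Any.Properties using (any⁺; any⁻)
open import Data.List.Relation.Unary.Unique.Propositional using (Unique)
import Data.List.Relation.Unary.Unique.Propositional.Properties as Unique
open import Data.List.Membership.Propositional using (_∈_; _∉_; find; lose)
open import Data.List.Membership.Propositional.Properties
  using (∈-++⁺ˡ; ∈-++⁺ʳ; ∈-++⁻; ∈-∃++; ∈-map⁺; ∈-map⁻; ∈-concatMap⁺; ∈-concatMap⁻;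
         ∈-upTo⁺; ∈-upTo⁻; ∈-filter⁺; ∈-filter⁻; ∈-cartesianProductWith⁺; ∈-cartesianProductWith⁻)
open import Data.List.Membership.Propositional.Properties.WithK using (unique∧set⇒bag)
open import Data.List.Membership.DecPropositional _≟_ using (_∈?_)
open import Data.List.Relation.Binary.BagAndSetEquality using (∼bag⇒↭)
open import Data.List.Relation.Binary.Permutation.Propositional.Properties using (↭-length)
open import Data.List.Relation.Binary.Sublist.Propositional
  using (_⊆_; []; _∷_; _∷ʳ_; from∈; minimum; ⊆-refl; ⊆-trans; lookup)
import Data.List.Relation.Binary.Sublist.Propositional.Properties as Sublist
open import Data.Product using (∃; ∃₂; _×_; _,_; proj₁; proj₂)
open import Data.Sum using (inj₁; inj₂)
open import Data.Empty using (⊥; ⊥-elim)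
open import Data.Unit using (tt)
open import Function using (_∘_; _⇔_; mk⇔; Equivalence)
open import Relation.Binary.PropositionalEquality
  using (_≢_; _≗_; refl; sym; trans; cong; cong₂; subst; module ≡-Reasoning)
open import Relation.Binary.Definitions using (tri<; tri≈; tri>)
open import Relation.Nullary using (¬_; yes; no)
open import Relation.Nullary.Decidable using (does)

double : ℕ → ℕ
double zero    = zero
double (suc t) = suc (suc (double t))

data Parity : ℕ → Set where
  even : ∀ t → Parity (double t)
  odd  : ∀ t → Parity (suc (double t))

parity : ∀ n → Parity n
parity zero = even 0
parity (suc n) with parity n
... | even t = odd t
... | odd t  = even (suc t)

double-cancel-≤ : ∀ {s t} → double s ≤ double t → s ≤ t
double-cancel-≤ {zero}          _              = z≤n
double-cancel-≤ {suc s} {suc t} (s≤s (s≤s le)) = s≤s (double-cancel-≤ le)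

double-cancel-≤-suc : ∀ {s t} → double s ≤ suc (double t) → s ≤ t
double-cancel-≤-suc {zero}          _              = z≤n
double-cancel-≤-suc {suc s} {suc t} (s≤s (s≤s le)) = s≤s (double-cancel-≤-suc le)

double-injective : ∀ {s t} → double s ≡ double t → s ≡ t
double-injective {zero}  {zero}  _  = refl
double-injective {suc s} {suc t} eq = cong suc (double-injective (suc-injective (suc-injective eq)))

double-+ : ∀ s t → double s + double t ≡ double (s + t)
double-+ zero    t = refl
double-+ (suc s) t = cong (suc ∘ suc) (double-+ s t)

double-∸ : ∀ t s → double t ∸ double s ≡ double (t ∸ s)
double-∸ t       zero    = refl
double-∸ zero    (suc s) = refl
double-∸ (suc t) (suc s) = double-∸ t s

double-∸-+ : ∀ {s t} → s ≤ t → double (t ∸ s) + double s ≡ double t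
double-∸-+ {s} {t} s≤t = trans (double-+ (t ∸ s) s) (cong double (m∸n+n≡m s≤t))

split-length : ∀ {s t} → suc s ≤ t → suc (double (t ∸ suc s)) + double (suc s) ≡ suc (double t)
split-length s<t = cong suc (double-∸-+ s<t)

odd∸double : ∀ {s t} → s ≤ t → suc (double t) ∸ double s ≡ suc (double (t ∸ s))
odd∸double {zero}          z≤n       = refl
odd∸double {suc s} {suc t} (s≤s s≤t) = odd∸double s≤t

sumTo-cong : ∀ n {f g : ℕ → ℕ} → (∀ i → i ≤ n → f i ≡ g i) → sumTo n f ≡ sumTo n g
sumTo-cong zero    f≡g = f≡g 0 z≤n
sumTo-cong (suc n) f≡g =
  cong₂ _+_ (sumTo-cong n (λ i i≤n → f≡g i (m≤n⇒m≤1+n i≤n))) (f≡g (suc n) ≤-refl)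

sumTo-suc : ∀ n (f : ℕ → ℕ) → sumTo (suc n) f ≡ f 0 + sumTo n (f ∘ suc)
sumTo-suc zero    f = refl
sumTo-suc (suc n) f = trans (cong (_+ f (2 + n)) (sumTo-suc n f)) (+-assoc (f 0) _ _)

sumTo-zero : ∀ n {f : ℕ → ℕ} → (∀ i → i ≤ n → f i ≡ 0) → sumTo n f ≡ 0
sumTo-zero n f≡0 = trans (sumTo-cong n f≡0) (zeros n)
  where
  zeros : ∀ n → sumTo n (λ _ → 0) ≡ 0
  zeros zero    = refl
  zeros (suc n) = cong (_+ 0) (zeros n)

sumTo-distrib-+ : ∀ n (f g : ℕ → ℕ) → sumTo n (λ i → f i + g i) ≡ sumTo n f + sumTo n g
sumTo-distrib-+ zero    f g = refl
sumTo-distrib-+ (suc n) f g =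
  trans (cong (_+ (f (suc n) + g (suc n))) (sumTo-distrib-+ n f g))
        (interchange (sumTo n f) (sumTo n g) (f (suc n)) (g (suc n)))
  where
  interchange : ∀ a b c d → a + b + (c + d) ≡ a + c + (b + d)
  interchange = solve-∀

sumTo-*ˡ : ∀ n c (f : ℕ → ℕ) → sumTo n (λ i → c * f i) ≡ c * sumTo n f
sumTo-*ˡ zero    c f = refl
sumTo-*ˡ (suc n) c f =
  trans (cong (_+ c * f (suc n)) (sumTo-*ˡ n c f)) (sym (*-distribˡ-+ c (sumTo n f) (f (suc n))))

sumTo-reverse : ∀ n (f : ℕ → ℕ) → sumTo n f ≡ sumTo n (λ i → f (n ∸ i))
sumTo-reverse zero    f = refl
sumTo-reverse (suc n) f = begin
  sumTo n f + f (suc n)                     ≡⟨ +-comm (sumTo n f) (f (suc n)) ⟩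
  f (suc n) + sumTo n f                     ≡⟨ cong (f (suc n) +_) (sumTo-reverse n f) ⟩
  f (suc n) + sumTo n (λ i → f (n ∸ i))     ≡⟨ sumTo-suc n (λ i → f (suc n ∸ i)) ⟨
  sumTo (suc n) (λ i → f (suc n ∸ i))       ∎
  where open ≡-Reasoning

sumTo-comm : ∀ n m (F : ℕ → ℕ → ℕ) →
             sumTo n (λ i → sumTo m (F i)) ≡ sumTo m (λ j → sumTo n (λ i → F i j))
sumTo-comm zero    m F = refl
sumTo-comm (suc n) m F =
  trans (cong (_+ sumTo m (F (suc n))) (sumTo-comm n m F))
        (sym (sumTo-distrib-+ m (λ j → sumTo n (λ i → F i j)) (F (suc n))))

sumTo-truncate : ∀ {m} n (f : ℕ → ℕ) → m ≤ n → (∀ i → m < i → i ≤ n → f i ≡ 0) →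
                 sumTo n f ≡ sumTo m f
sumTo-truncate         zero    f z≤n  _     = refl
sumTo-truncate {m} (suc n) f m≤1+n tail≡0 with m ≤? n
... | yes m≤n = trans (cong₂ _+_ (sumTo-truncate n f m≤n (λ i m<i i≤n → tail≡0 i m<i (m≤n⇒m≤1+n i≤n)))
                                 (tail≡0 (suc n) (s≤s m≤n) ≤-refl))
                      (+-identityʳ _)
... | no m≰n rewrite ≤-antisym m≤1+n (≰⇒> m≰n) = refl

sumTo-evens : ∀ t (f : ℕ → ℕ) → (∀ s → f (suc (double s)) ≡ 0) →
              sumTo (double t) f ≡ sumTo t (f ∘ double)
sumTo-evens zero    f odd≡0 = refl
sumTo-evens (suc t) f odd≡0
  rewrite odd≡0 t | sumTo-evens t f odd≡0 = cong (_+ f (double (suc t))) (+-identityʳ _)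

-- Power series

⊛-congˡ : ∀ {f f′} g → f ≗ f′ → f ⊛ g ≗ f′ ⊛ g
⊛-congˡ g f≗f′ n = sumTo-cong n (λ i _ → cong (_* g (n ∸ i)) (f≗f′ i))

⊛-congʳ : ∀ n f {g g′} → (∀ i → i ≤ n → g i ≡ g′ i) → (f ⊛ g) n ≡ (f ⊛ g′) n
⊛-congʳ n f g≡g′ = sumTo-cong n (λ i _ → cong (f i *_) (g≡g′ (n ∸ i) (m∸n≤m n i)))

⊛-suc : ∀ n f g → (f ⊛ g) (suc n) ≡ f 0 * g (suc n) + ((f ∘ suc) ⊛ g) n
⊛-suc n f g = sumTo-suc n (λ i → f i * g (suc n ∸ i))

⊛-comm : ∀ f g → f ⊛ g ≗ g ⊛ f
⊛-comm f g n = trans (sumTo-reverse n _) (sumTo-cong n swap)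
  where
  swap : ∀ i → i ≤ n → f (n ∸ i) * g (n ∸ (n ∸ i)) ≡ g i * f (n ∸ i)
  swap i i≤n rewrite m∸[m∸n]≡n i≤n = *-comm (f (n ∸ i)) (g i)

⊛-distribˡ-⊕ : ∀ f g h → f ⊛ (g ⊕ h) ≗ f ⊛ g ⊕ f ⊛ h
⊛-distribˡ-⊕ f g h n =
  trans (sumTo-cong n (λ i _ → *-distribˡ-+ (f i) (g (n ∸ i)) (h (n ∸ i)))) (sumTo-distrib-+ n _ _)

⊛-distribʳ-⊕ : ∀ f g h → (f ⊕ g) ⊛ h ≗ f ⊛ h ⊕ g ⊛ h
⊛-distribʳ-⊕ f g h n =
  trans (sumTo-cong n (λ i _ → *-distribʳ-+ (h (n ∸ i)) (f i) (g i))) (sumTo-distrib-+ n _ _)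

⊛-*ˡ : ∀ c f g → (λ i → c * f i) ⊛ g ≗ (λ n → c * (f ⊛ g) n)
⊛-*ˡ c f g n = trans (sumTo-cong n (λ i _ → *-assoc c (f i) _)) (sumTo-*ˡ n c _)

⊛-assoc : ∀ f g h → (f ⊛ g) ⊛ h ≗ f ⊛ (g ⊛ h)
⊛-assoc f g h zero    = *-assoc (f 0) (g 0) (h 0)
⊛-assoc f g h (suc n) = begin
  ((f ⊛ g) ⊛ h) (suc n)
    ≡⟨ ⊛-suc n (f ⊛ g) h ⟩
  f 0 * g 0 * h (suc n) + (((f ⊛ g) ∘ suc) ⊛ h) n
    ≡⟨ cong (f 0 * g 0 * h (suc n) +_) (⊛-congˡ h (λ i → ⊛-suc i f g) n) ⟩
  f 0 * g 0 * h (suc n) + (((λ i → f 0 * g (suc i)) ⊕ (f ∘ suc) ⊛ g) ⊛ h) n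
    ≡⟨ cong (f 0 * g 0 * h (suc n) +_) (⊛-distribʳ-⊕ (λ i → f 0 * g (suc i)) ((f ∘ suc) ⊛ g) h n) ⟩
  f 0 * g 0 * h (suc n) + (((λ i → f 0 * g (suc i)) ⊛ h) n + (((f ∘ suc) ⊛ g) ⊛ h) n)
    ≡⟨ cong₂ (λ a b → f 0 * g 0 * h (suc n) + (a + b)) (⊛-*ˡ (f 0) (g ∘ suc) h n) (⊛-assoc (f ∘ suc) g h n) ⟩
  f 0 * g 0 * h (suc n) + (f 0 * ((g ∘ suc) ⊛ h) n + ((f ∘ suc) ⊛ (g ⊛ h)) n)
    ≡⟨ regroup (f 0) (g 0) (h (suc n)) (((g ∘ suc) ⊛ h) n) (((f ∘ suc) ⊛ (g ⊛ h)) n) ⟩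
  f 0 * (g 0 * h (suc n) + ((g ∘ suc) ⊛ h) n) + ((f ∘ suc) ⊛ (g ⊛ h)) n
    ≡⟨ cong (λ v → f 0 * v + ((f ∘ suc) ⊛ (g ⊛ h)) n) (⊛-suc n g h) ⟨
  f 0 * (g ⊛ h) (suc n) + ((f ∘ suc) ⊛ (g ⊛ h)) n
    ≡⟨ ⊛-suc n f (g ⊛ h) ⟨
  (f ⊛ (g ⊛ h)) (suc n)
    ∎
  where
  open ≡-Reasoning
  regroup : ∀ a b c d e → a * b * c + (a * d + e) ≡ a * (b * c + d) + e
  regroup = solve-∀

⊛-identityˡ : ∀ f → one ⊛ f ≗ f
⊛-identityˡ f zero    = +-identityʳ (f 0)
⊛-identityˡ f (suc n) =
  trans (⊛-suc n one f)
        (trans (cong₂ _+_ (+-identityʳ (f (suc n))) (sumTo-zero n (λ _ _ → refl))) (+-identityʳ _))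

⊛-identityʳ : ∀ f → f ⊛ one ≗ f
⊛-identityʳ f n = trans (⊛-comm f one n) (⊛-identityˡ f n)

X⊛-suc : ∀ f n → (X ⊛ f) (suc n) ≡ f n
X⊛-suc f n = trans (⊛-suc n X f) (trans (⊛-congˡ f X∘suc≗one n) (⊛-identityˡ f n))
  where
  X∘suc≗one : X ∘ suc ≗ one
  X∘suc≗one zero    = refl
  X∘suc≗one (suc _) = refl

X²⊛-suc-suc : ∀ f n → (X ⊛ X ⊛ f) (suc (suc n)) ≡ f n
X²⊛-suc-suc f n = begin
  (X ⊛ X ⊛ f) (suc (suc n))    ≡⟨ ⊛-assoc X X f (suc (suc n)) ⟩
  (X ⊛ (X ⊛ f)) (suc (suc n))  ≡⟨ X⊛-suc (X ⊛ f) (suc n) ⟩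
  (X ⊛ f) (suc n)              ≡⟨ X⊛-suc f n ⟩
  f n                          ∎
  where open ≡-Reasoning

pow-vanishes : ∀ B → B 0 ≡ 0 → ∀ {j m} → m < j → pow B j m ≡ 0
pow-vanishes B B₀≡0 {suc j} {m} m<1+j = sumTo-zero m term≡0
  where
  term≡0 : ∀ i → i ≤ m → B i * pow B j (m ∸ i) ≡ 0
  term≡0 zero    _   rewrite B₀≡0 = refl
  term≡0 (suc i) i<m rewrite pow-vanishes B B₀≡0 {j} {m ∸ suc i}
                               (≤-trans (∸-monoʳ-< {m} {suc i} {0} z<s i<m) (≤-pred m<1+j))
    = *-zeroʳ (B (suc i))

sumTo-⊛ : ∀ N n B (P : ℕ → PS) →
          sumTo N (λ j → (B ⊛ P j) n) ≡ (B ⊛ (λ m → sumTo N (λ j → P j m))) n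
sumTo-⊛ N n B P =
  sym (trans (sumTo-cong n (λ i _ → sym (sumTo-*ˡ N (B i) (λ j → P j (n ∸ i))))) (sumTo-comm n N _))

geom-unfold : ∀ B → B 0 ≡ 0 → geom B ≗ one ⊕ B ⊛ geom B
geom-unfold B B₀≡0 n = begin
  sumTo n (λ j → pow B j n)
    ≡⟨ sumTo-truncate (suc n) _ (n≤1+n n) (λ j n<j _ → pow-vanishes B B₀≡0 (≤-trans (s≤s ≤-refl) n<j)) ⟨
  sumTo (suc n) (λ j → pow B j n)
    ≡⟨ sumTo-suc n _ ⟩
  one n + sumTo n (λ j → (B ⊛ pow B j) n)
    ≡⟨ cong (one n +_) (sumTo-⊛ n n B (pow B)) ⟩
  one n + (B ⊛ (λ m → sumTo n (λ j → pow B j m))) n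
    ≡⟨ cong (one n +_) (⊛-congʳ n B (λ m m≤n → sumTo-truncate n _ m≤n (λ j m<j _ → pow-vanishes B B₀≡0 m<j))) ⟩
  one n + (B ⊛ geom B) n
    ∎
  where open ≡-Reasoning

EvenSeries : PS → Set
EvenSeries f = ∀ t → f (suc (double t)) ≡ 0

one-even : EvenSeries one
one-even t = refl

X²-even : EvenSeries (X ⊛ X)
X²-even t = trans (X⊛-suc X (double t)) (X-double t)
  where
  X-double : ∀ t → X (double t) ≡ 0
  X-double zero    = refl
  X-double (suc t) = refl

⊕-even : ∀ f g → EvenSeries f → EvenSeries g → EvenSeries (f ⊕ g)
⊕-even f g f-even g-even t = cong₂ _+_ (f-even t) (g-even t)

⊛-even : ∀ f g → EvenSeries f → EvenSeries g → EvenSeries (f ⊛ g)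
⊛-even f g f-even g-even t = sumTo-zero (suc (double t)) term≡0
  where
  term≡0 : ∀ i → i ≤ suc (double t) → f i * g (suc (double t) ∸ i) ≡ 0
  term≡0 i i≤n with parity i
  ... | even s rewrite odd∸double (double-cancel-≤-suc i≤n) | g-even (t ∸ s) = *-zeroʳ (f (double s))
  ... | odd s  rewrite f-even s = refl

pow-even : ∀ B → EvenSeries B → ∀ j → EvenSeries (pow B j)
pow-even B B-even zero    = one-even
pow-even B B-even (suc j) = ⊛-even B (pow B j) B-even (pow-even B B-even j)

geom-even : ∀ B → EvenSeries B → EvenSeries (geom B)
geom-even B B-even t = sumTo-zero (suc (double t)) (λ j _ → pow-even B B-even j t)

-- The series G and the claimed generating function

-- G (suc (suc r)) is definitionally one ⊕ H r.
H : ℕ → PS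
H r = X ⊛ X ⊛ G (suc r) ⊛ geom (X ⊛ X ⊛ G r)

H-unfold : ∀ r → H r ≗ X ⊛ X ⊛ G (suc r) ⊕ (X ⊛ X ⊛ G r) ⊛ H r
H-unfold r n = begin
  (A ⊛ geom B) n                   ≡⟨ ⊛-congʳ n A (λ i _ → geom-unfold B refl i) ⟩
  (A ⊛ (one ⊕ B ⊛ geom B)) n       ≡⟨ ⊛-distribˡ-⊕ A one (B ⊛ geom B) n ⟩
  (A ⊛ one) n + (A ⊛ (B ⊛ geom B)) n
    ≡⟨ cong₂ _+_ (⊛-identityʳ A n) (sym (⊛-assoc A B (geom B) n)) ⟩
  A n + ((A ⊛ B) ⊛ geom B) n
    ≡⟨ cong (A n +_) (trans (⊛-congˡ (geom B) (⊛-comm A B) n) (⊛-assoc B A (geom B) n)) ⟩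
  A n + (B ⊛ (A ⊛ geom B)) n       ∎
  where
  open ≡-Reasoning
  A B : PS
  A = X ⊛ X ⊛ G (suc r)
  B = X ⊛ X ⊛ G r

G-suc-suc : ∀ r n → G (suc (suc r)) (suc (suc n)) ≡ G (suc r) n + (G r ⊛ H r) n
G-suc-suc r n = begin
  H r (suc (suc n))
    ≡⟨ H-unfold r (suc (suc n)) ⟩
  (X ⊛ X ⊛ G (suc r)) (suc (suc n)) + ((X ⊛ X ⊛ G r) ⊛ H r) (suc (suc n))
    ≡⟨ cong₂ _+_ (X²⊛-suc-suc (G (suc r)) n) (⊛-assoc (X ⊛ X) (G r) (H r) (suc (suc n))) ⟩
  G (suc r) n + (X ⊛ X ⊛ (G r ⊛ H r)) (suc (suc n))
    ≡⟨ cong (G (suc r) n +_) (X²⊛-suc-suc (G r ⊛ H r) n) ⟩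
  G (suc r) n + (G r ⊛ H r) n
    ∎
  where open ≡-Reasoning

G-even : ∀ r → EvenSeries (G r)
G-even zero          = one-even
G-even (suc zero)    = one-even
G-even (suc (suc r)) =
  ⊕-even one (H r) one-even (⊛-even (X ⊛ X ⊛ G (suc r)) (geom (X ⊛ X ⊛ G r))
                                      (X²G-even (suc r)) (geom-even (X ⊛ X ⊛ G r) (X²G-even r)))
  where
  X²G-even : ∀ q → EvenSeries (X ⊛ X ⊛ G q)
  X²G-even q = ⊛-even (X ⊛ X) (G q) X²-even (G-even q)

-- 𝒟 j is the right-hand side of the theorem for the pattern of length k = j + 2.
𝒟 : ℕ → PS
𝒟 j = G (suc j) ⊕ X ⊛ G j

𝒟-zero : ∀ j → 𝒟 j 0 ≡ 1
𝒟-zero zero    = refl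
𝒟-zero (suc j) = refl

𝒟₀-suc-suc : ∀ n → 𝒟 0 (suc (suc n)) ≡ 0
𝒟₀-suc-suc n = X⊛-suc one (suc n)

𝒟-odd≡G : ∀ j t → 𝒟 j (suc (double t)) ≡ G j (double t)
𝒟-odd≡G j t = cong₂ _+_ (G-even (suc j) t) (X⊛-suc (G j) (double t))

𝒟-even≡G : ∀ j t → 𝒟 j (double t) ≡ G (suc j) (double t)
𝒟-even≡G zero    zero    = refl
𝒟-even≡G (suc j) zero    = refl
𝒟-even≡G j       (suc t) =
  trans (cong (G (suc j) (double (suc t)) +_) (trans (X⊛-suc (G j) (suc (double t))) (G-even j t)))
        (+-identityʳ _)

𝒟-suc-odd : ∀ j t → 𝒟 (suc j) (suc (double t)) ≡ 𝒟 j (double t)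
𝒟-suc-odd j t = trans (𝒟-odd≡G (suc j) t) (sym (𝒟-even≡G j t))

-- Counts the good arrangements of length 2t + 2 whose maximum has 2s > 0 entries after it
-- and at least one before it.
splitCount : ℕ → ℕ → ℕ → ℕ
splitCount j t zero    = 0
splitCount j t (suc s) = 𝒟 j (suc (double (t ∸ suc s))) * 𝒟 (suc j) (double (suc s))

𝒟-suc-even : ∀ j t → 𝒟 (suc j) (double (suc t)) ≡ 𝒟 (suc j) (suc (double t)) + sumTo t (splitCount j t)
𝒟-suc-even j t = begin
  𝒟 (suc j) (double (suc t))
    ≡⟨ 𝒟-even≡G (suc j) (suc t) ⟩
  G (suc (suc j)) (suc (suc (double t)))
    ≡⟨ G-suc-suc j (double t) ⟩
  G (suc j) (double t) + (G j ⊛ H j) (double t)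
    ≡⟨ cong₂ _+_ (𝒟-odd≡G (suc j) t) (⊛-comm (H j) (G j) (double t)) ⟨
  𝒟 (suc j) (suc (double t)) + (H j ⊛ G j) (double t)
    ≡⟨ cong (𝒟 (suc j) (suc (double t)) +_) (sumTo-evens t _ odd-terms≡0) ⟩
  𝒟 (suc j) (suc (double t)) + sumTo t (λ s → H j (double s) * G j (double t ∸ double s))
    ≡⟨ cong (𝒟 (suc j) (suc (double t)) +_) (sumTo-cong t term≡) ⟩
  𝒟 (suc j) (suc (double t)) + sumTo t (splitCount j t)
    ∎
  where
  open ≡-Reasoning
  odd-terms≡0 : ∀ s → H j (suc (double s)) * G j (double t ∸ suc (double s)) ≡ 0
  odd-terms≡0 s = cong (_* G j (double t ∸ suc (double s))) (G-even (suc (suc j)) s)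
  term≡ : ∀ s → s ≤ t → H j (double s) * G j (double t ∸ double s) ≡ splitCount j t s
  term≡ zero    _ = refl
  term≡ (suc s) _ rewrite double-∸ t (suc s) | 𝒟-odd≡G j (t ∸ suc s) | 𝒟-even≡G (suc j) (suc s) =
    *-comm (H j (double (suc s))) (G j (double (t ∸ suc s)))

T-∧⁻ : ∀ {x y} → T (x ∧ y) → T x × T y
T-∧⁻ = Equivalence.to T-∧

T-∧⁺ : ∀ {x y} → T x → T y → T (x ∧ y)
T-∧⁺ tx ty = Equivalence.from T-∧ (tx , ty)

T-not⁻ : ∀ {x} → T (not x) → ¬ T x
T-not⁻ {true} ()

T-not⁺ : ∀ {x} → ¬ T x → T (not x)
T-not⁺ {false} _   = tt
T-not⁺ {true}  ¬tx = ¬tx tt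

≡ᵇ-false⇒≢ : ∀ a b → T (not (a ≡ᵇ b)) → a ≢ b
≡ᵇ-false⇒≢ a b a≢ᵇb = T-not⁻ a≢ᵇb ∘ ≡⇒≡ᵇ a b

≢⇒≡ᵇ-false : ∀ a b → a ≢ b → T (not (a ≡ᵇ b))
≢⇒≡ᵇ-false a b a≢b = T-not⁺ (a≢b ∘ ≡ᵇ⇒≡ a b)

<ᵇ-true : ∀ {a b} → a < b → (a <ᵇ b) ≡ true
<ᵇ-true a<b = Equivalence.to T-≡ (<⇒<ᵇ a<b)

<ᵇ-false : ∀ {a b} → b ≤ a → (a <ᵇ b) ≡ false
<ᵇ-false {a} {b} b≤a with a <ᵇ b in a<ᵇb
... | false = refl
... | true  = ⊥-elim (<⇒≱ (<ᵇ⇒< a b (subst T (sym a<ᵇb) tt)) b≤a)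

<ᵇ-false⇒≥ : ∀ a b → T (not (a <ᵇ b)) → b ≤ a
<ᵇ-false⇒≥ a b ¬a<b = ≮⇒≥ (T-not⁻ ¬a<b ∘ <⇒<ᵇ)

≟-sound : ∀ {x y} → T (does (x Bool.≟ y)) → x ≡ y
≟-sound {true}  {true}  _ = refl
≟-sound {false} {false} _ = refl

≟-complete : ∀ {x y} → x ≡ y → T (does (x Bool.≟ y))
≟-complete {true}  refl = tt
≟-complete {false} refl = tt

private
  variable
    A B C : Set

Unique-map⁺-on : ∀ {f : A → B} {xs} → (∀ {x y} → x ∈ xs → y ∈ xs → f x ≡ f y → x ≡ y) →
                 Unique xs → Unique (map f xs)
Unique-map⁺-on {xs = []}     inj []             = []
Unique-map⁺-on {xs = x ∷ xs} inj (x∉xs ∷ uxs) =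
  apart x∉xs (λ y∈xs → inj (here refl) (there y∈xs)) ∷
  Unique-map⁺-on (λ x∈ y∈ → inj (there x∈) (there y∈)) uxs
  where
  apart : ∀ {ys} → All (x ≢_) ys → (∀ {y} → y ∈ ys → _ → x ≡ y) → All (_ ≢_) (map _ ys)
  apart []            _   = []
  apart (x≢y ∷ x≢ys) inj′ = (x≢y ∘ inj′ (here refl)) ∷ apart x≢ys (inj′ ∘ there)

Unique-concatMap⁺ : ∀ {f : A → List B} {xs} → Unique xs → (∀ {x} → x ∈ xs → Unique (f x)) →
                    (∀ {x y z} → x ∈ xs → y ∈ xs → z ∈ f x → z ∈ f y → x ≡ y) →
                    Unique (concatMap f xs)
Unique-concatMap⁺ {xs = []}     _              _     _        = []
Unique-concatMap⁺ {f = f} {xs = x ∷ xs} (x∉xs ∷ uxs) ufx apart =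
  Unique.++⁺ (ufx (here refl))
             (Unique-concatMap⁺ uxs (ufx ∘ there) (λ x∈ y∈ → apart (there x∈) (there y∈)))
             disjoint
  where
  disjoint : ∀ {z} → ¬ (z ∈ f x × z ∈ concatMap f xs)
  disjoint (z∈fx , z∈rest) with find (∈-concatMap⁻ f {xs} z∈rest)
  ... | y , y∈xs , z∈fy = All.lookup x∉xs y∈xs (apart (here refl) (there y∈xs) z∈fx z∈fy)

Unique-cartesianProductWith⁺-on : ∀ {f : A → B → C} {xs ys} →
  (∀ {a a′ b b′} → a ∈ xs → a′ ∈ xs → b ∈ ys → b′ ∈ ys → f a b ≡ f a′ b′ → a ≡ a′ × b ≡ b′) →
  Unique xs → Unique ys → Unique (cartesianProductWith f xs ys)
Unique-cartesianProductWith⁺-on {xs = []}     _   _              _   = []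
Unique-cartesianProductWith⁺-on {f = f} {xs = x ∷ xs} {ys} inj (x∉xs ∷ uxs) uys =
  Unique.++⁺ (Unique-map⁺-on (λ b∈ b′∈ → proj₂ ∘ inj (here refl) (here refl) b∈ b′∈) uys)
             (Unique-cartesianProductWith⁺-on (λ a∈ a′∈ → inj (there a∈) (there a′∈)) uxs uys)
             apart
  where
  apart : ∀ {z} → ¬ (z ∈ map (f x) ys × z ∈ cartesianProductWith f xs ys)
  apart (z∈ , z∈′) with ∈-map⁻ (f x) z∈ | ∈-cartesianProductWith⁻ f xs ys z∈′
  ... | b , b∈ , refl | a , b′ , a∈ , b′∈ , eq =
    All.lookup x∉xs a∈ (proj₁ (inj (here refl) (there a∈) b∈ b′∈ eq))

Unique-++⁻ : ∀ (xs : List A) {ys} → Unique (xs ++ ys) → Unique xs × Unique ys × (∀ {x} → x ∈ xs → x ∉ ys)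
Unique-++⁻ []       uys            = [] , uys , λ ()
Unique-++⁻ (x ∷ xs) (x∉xs++ys ∷ u) with Unique-++⁻ xs u
... | uxs , uys , apart = All.++⁻ˡ xs x∉xs++ys ∷ uxs , uys , apart′
  where
  apart′ : ∀ {z} → z ∈ x ∷ xs → z ∉ _
  apart′ (here refl) z∈ys = All.lookup (All.++⁻ʳ xs x∉xs++ys) z∈ys refl
  apart′ (there z∈xs) = apart z∈xs

Unique-length-≤ : ∀ {xs ys : List A} → Unique xs → (∀ {x} → x ∈ xs → x ∈ ys) → length xs ≤ length ys
Unique-length-≤ {xs = []}                _              _     = z≤n
Unique-length-≤ {xs = x ∷ xs} {ys} (x∉xs ∷ uxs) xs⊆ys with ∈-∃++ (xs⊆ys (here refl))
... | us , vs , refl = begin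
  suc (length xs)         ≤⟨ s≤s (Unique-length-≤ uxs xs⊆us++vs) ⟩
  suc (length (us ++ vs)) ≡⟨ length-++-sucʳ us x vs ⟨
  length (us ++ x ∷ vs)   ∎
  where
  open ≤-Reasoning
  xs⊆us++vs : ∀ {y} → y ∈ xs → y ∈ us ++ vs
  xs⊆us++vs {y} y∈xs with ∈-++⁻ us (xs⊆ys (there y∈xs))
  ... | inj₁ y∈us         = ∈-++⁺ˡ y∈us
  ... | inj₂ (here refl)  = ⊥-elim (All.lookup x∉xs y∈xs refl)
  ... | inj₂ (there y∈vs) = ∈-++⁺ʳ us y∈vs

Unique-length-≡ : ∀ {xs ys : List A} → Unique xs → Unique ys →
                  (∀ {z} → z ∈ xs → z ∈ ys) → (∀ {z} → z ∈ ys → z ∈ xs) → length xs ≡ length ys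
Unique-length-≡ uxs uys xs⊆ys ys⊆xs =
  ↭-length (∼bag⇒↭ (unique∧set⇒bag uxs uys (mk⇔ xs⊆ys ys⊆xs)))

length-cartesianProductWith : ∀ (f : A → B → C) xs ys →
                              length (cartesianProductWith f xs ys) ≡ length xs * length ys
length-cartesianProductWith f []       ys = refl
length-cartesianProductWith f (x ∷ xs) ys =
  trans (length-++ (map (f x) ys)) (cong₂ _+_ (length-map (f x) ys) (length-cartesianProductWith f xs ys))

length-concatMap-applyUpTo : ∀ (g : ℕ → List A) h t →
                             length (concatMap g (applyUpTo h (suc t))) ≡ sumTo t (length ∘ g ∘ h)
length-concatMap-applyUpTo g h zero    = trans (length-++ (g (h 0))) (+-identityʳ _)
length-concatMap-applyUpTo g h (suc t) = begin
  length (g (h 0) ++ concatMap g (applyUpTo (h ∘ suc) (suc t)))  ≡⟨ length-++ (g (h 0)) ⟩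
  length (g (h 0)) + length (concatMap g (applyUpTo (h ∘ suc) (suc t)))
    ≡⟨ cong (length (g (h 0)) +_) (length-concatMap-applyUpTo g (h ∘ suc) t) ⟩
  length (g (h 0)) + sumTo t (length ∘ g ∘ h ∘ suc)               ≡⟨ sumTo-suc t (length ∘ g ∘ h) ⟨
  sumTo (suc t) (length ∘ g ∘ h)                                  ∎
  where open ≡-Reasoning

++-∷-cancel : ∀ {x : A} α α′ {β β′} → x ∉ α → x ∉ α′ →
              α ++ x ∷ β ≡ α′ ++ x ∷ β′ → α ≡ α′ × β ≡ β′
++-∷-cancel []      []        _    _     refl = refl , refl
++-∷-cancel []      (a′ ∷ α′) _    x∉α′  eq   = ⊥-elim (x∉α′ (here (proj₁ (∷-injective eq))))
++-∷-cancel (a ∷ α) []        x∉α  _     eq   = ⊥-elim (x∉α (here (sym (proj₁ (∷-injective eq)))))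
++-∷-cancel (a ∷ α) (a′ ∷ α′) x∉α  x∉α′  eq   with ∷-injective eq
... | refl , eq′ with ++-∷-cancel α α′ (x∉α ∘ there) (x∉α′ ∘ there) eq′
...   | refl , refl = refl , refl

-- Arrangements of an interval

InRange : ℕ → ℕ → ℕ → Set
InRange lo hi x = lo < x × x ≤ hi

range : ℕ → ℕ → List ℕ
range lo zero    = []
range lo (suc k) = suc lo ∷ range (suc lo) k

length-range : ∀ lo k → length (range lo k) ≡ k
length-range lo zero    = refl
length-range lo (suc k) = cong suc (length-range (suc lo) k)

∈-range : ∀ lo k {x} → InRange lo (lo + k) x → x ∈ range lo k
∈-range lo zero    (lo<x , x≤lo+0) = ⊥-elim (<⇒≱ lo<x (subst (_ ≤_) (+-identityʳ lo) x≤lo+0))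
∈-range lo (suc k) {x} (lo<x , x≤lo+1+k) with x ≟ suc lo
... | yes refl = here refl
... | no x≢1+lo = there (∈-range (suc lo) k (≤∧≢⇒< lo<x (x≢1+lo ∘ sym) , subst (x ≤_) (+-suc lo k) x≤lo+1+k))

Unique-InRange-length : ∀ {lo hi xs} → Unique xs → All (InRange lo hi) xs → length xs ≤ hi ∸ lo
Unique-InRange-length {lo} {hi} {xs} uxs xs-in-range =
  subst (length xs ≤_) (length-range lo (hi ∸ lo)) (Unique-length-≤ uxs (in-range ∘ All.lookup xs-in-range))
  where
  in-range : ∀ {x} → InRange lo hi x → x ∈ range lo (hi ∸ lo)
  in-range {x} (lo<x , x≤hi) =
    ∈-range lo (hi ∸ lo) (lo<x , subst (x ≤_) (sym (m+[n∸m]≡n (<⇒≤ (<-≤-trans lo<x x≤hi)))) x≤hi)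

record Arrangement (lo len : ℕ) (π : List ℕ) : Set where
  field
    length≡ : length π ≡ len
    unique  : Unique π
    inRange : All (InRange lo (lo + len)) π

open Arrangement

Arrangement-cong : ∀ {lo lo′ len len′ π} → lo ≡ lo′ → len ≡ len′ →
                   Arrangement lo len π → Arrangement lo′ len′ π
Arrangement-cong refl refl arr = arr

empty-arrangement : ∀ {lo} → Arrangement lo 0 []
empty-arrangement = record { length≡ = refl ; unique = [] ; inRange = [] }

-- Otherwise v ∷ π would be len + 1 distinct values in an interval of length len.
Arrangement-∋ : ∀ {lo len π v} → Arrangement lo len π → InRange lo (lo + len) v → v ∈ π
Arrangement-∋ {lo} {len} {π} {v} arr v-in-range with v ∈? π
... | yes v∈π = v∈π
... | no  v∉π = ⊥-elim (<-irrefl refl (begin-strict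
  len                    ≡⟨ length≡ arr ⟨
  length π               <⟨ ≤-refl ⟩
  length (v ∷ π)         ≤⟨ Unique-InRange-length (v≢π ∷ unique arr) (v-in-range ∷ inRange arr) ⟩
  lo + len ∸ lo          ≡⟨ m+n∸m≡n lo len ⟩
  len                    ∎))
  where
  open ≤-Reasoning
  v≢π : All (v ≢_) π
  v≢π = All.tabulate (λ x∈π v≡x → v∉π (subst (_∈ π) (sym v≡x) x∈π))

distinct⇒Unique : ∀ l → T (distinct l) → Unique l
distinct⇒Unique []      _  = []
distinct⇒Unique (a ∷ l) tl with T-∧⁻ {notElem a l} tl
... | a∉l , tl′ = All.map (≡ᵇ-false⇒≢ a _) (All.all⁺ _ l a∉l) ∷ distinct⇒Unique l tl′

Unique⇒distinct : ∀ {l} → Unique l → T (distinct l)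
Unique⇒distinct []         = tt
Unique⇒distinct (a∉l ∷ ul) = T-∧⁺ (All.all⁻ _ (All.map (≢⇒≡ᵇ-false _ _) a∉l)) (Unique⇒distinct ul)

words-cartesian : ∀ n m → words n (suc m) ≡ cartesianProductWith (λ w i → suc i ∷ w) (words n m) (upTo n)
words-cartesian n m = concatMap-map (words n m)
  where
  concatMap-map : ∀ ws → concatMap (λ w → map (λ i → suc i ∷ w) (upTo n)) ws
                       ≡ cartesianProductWith (λ w i → suc i ∷ w) ws (upTo n)
  concatMap-map []       = refl
  concatMap-map (w ∷ ws) = cong (map (λ i → suc i ∷ w) (upTo n) ++_) (concatMap-map ws)

∈-words⁻ : ∀ n m {w} → w ∈ words n m → length w ≡ m × All (InRange 0 n) w
∈-words⁻ n zero    (here refl) = refl , []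
∈-words⁻ n (suc m) w∈ rewrite words-cartesian n m
  with ∈-cartesianProductWith⁻ (λ w i → suc i ∷ w) (words n m) (upTo n) w∈
... | w , i , w∈ws , i∈upTo , refl with ∈-words⁻ n m w∈ws
... | |w|≡m , w-in-range = cong suc |w|≡m , (z<s , ∈-upTo⁻ i∈upTo) ∷ w-in-range

∈-words⁺ : ∀ n {w} → All (InRange 0 n) w → w ∈ words n (length w)
∈-words⁺ n []                         = here refl
∈-words⁺ n {suc x ∷ w} ((_ , x<n) ∷ w-in-range) rewrite words-cartesian n (length w) =
  ∈-cartesianProductWith⁺ (λ w i → suc i ∷ w) (∈-words⁺ n w-in-range) (∈-upTo⁺ x<n)

words-unique : ∀ n m → Unique (words n m)
words-unique n zero    = [] ∷ []
words-unique n (suc m) rewrite words-cartesian n m =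
  Unique.cartesianProductWith⁺ (λ w i → suc i ∷ w) ∷-injective′ (words-unique n m) (Unique.upTo⁺ n)
  where
  ∷-injective′ : ∀ {w w′ i i′} → (suc i ∷ w) ≡ (suc i′ ∷ w′) → w ≡ w′ × i ≡ i′
  ∷-injective′ refl = refl , refl

∈-perms⇔ : ∀ {n π} → π ∈ perms n ⇔ Arrangement 0 n π
∈-perms⇔ {n} {π} = mk⇔ to from
  where
  to : π ∈ perms n → Arrangement 0 n π
  to π∈ with ∈-filter⁻ (T? ∘ distinct) π∈
  ... | π∈words , distinct-π with ∈-words⁻ n n π∈words
  ... | |π|≡n , π-in-range =
    record { length≡ = |π|≡n ; unique = distinct⇒Unique π distinct-π ; inRange = π-in-range }
  from : Arrangement 0 n π → π ∈ perms n
  from arr = ∈-filter⁺ (T? ∘ distinct) (subst (λ m → π ∈ words n m) (length≡ arr) (∈-words⁺ n (inRange arr)))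
                       (Unique⇒distinct (unique arr))

perms-unique : ∀ n → Unique (perms n)
perms-unique n = Unique.filter⁺ (T? ∘ distinct) (words-unique n n)

-- Pattern occurrences

∈-subseqs⁻ : ∀ l {σ} → σ ∈ subseqs l → σ ⊆ l
∈-subseqs⁻ []      (here refl) = []
∈-subseqs⁻ (a ∷ l) σ∈ with ∈-++⁻ (map (a ∷_) (subseqs l)) σ∈
... | inj₂ σ∈′ = a ∷ʳ ∈-subseqs⁻ l σ∈′
... | inj₁ σ∈′ with ∈-map⁻ (a ∷_) σ∈′
...   | σ′ , σ′∈ , refl = refl ∷ ∈-subseqs⁻ l σ′∈

∈-subseqs⁺ : ∀ {l σ} → σ ⊆ l → σ ∈ subseqs l
∈-subseqs⁺ []                     = here refl
∈-subseqs⁺ {a ∷ l} (.a ∷ʳ σ⊆l)    = ∈-++⁺ʳ (map (a ∷_) (subseqs l)) (∈-subseqs⁺ σ⊆l)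
∈-subseqs⁺ {a ∷ l} (refl ∷ σ⊆l)   = ∈-++⁺ˡ (∈-map⁺ (a ∷_) (∈-subseqs⁺ σ⊆l))

Occurs : (List ℕ → Set) → List ℕ → Set
Occurs P π = ∃ λ σ → σ ⊆ π × P σ

Occurs-map : ∀ {P Q : List ℕ → Set} {π} → (∀ {σ} → P σ → Q σ) → Occurs P π → Occurs Q π
Occurs-map f (σ , σ⊆π , pσ) = σ , σ⊆π , f pσ

Occurs-⊆ : ∀ {P π π′} → π ⊆ π′ → Occurs P π → Occurs P π′
Occurs-⊆ π⊆π′ (σ , σ⊆π , pσ) = σ , ⊆-trans σ⊆π π⊆π′ , pσ

⊆-++-split : ∀ (α : List A) {γ σ} → σ ⊆ α ++ γ →
             ∃₂ λ σ₁ σ₂ → σ ≡ σ₁ ++ σ₂ × σ₁ ⊆ α × σ₂ ⊆ γ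
⊆-++-split []      σ⊆γ           = [] , _ , refl , [] , σ⊆γ
⊆-++-split (a ∷ α) (.a ∷ʳ σ⊆α++γ) with ⊆-++-split α σ⊆α++γ
... | σ₁ , σ₂ , refl , σ₁⊆α , σ₂⊆γ = σ₁ , σ₂ , refl , a ∷ʳ σ₁⊆α , σ₂⊆γ
⊆-++-split (a ∷ α) (refl ∷ σ⊆α++γ) with ⊆-++-split α σ⊆α++γ
... | σ₁ , σ₂ , refl , σ₁⊆α , σ₂⊆γ = a ∷ σ₁ , σ₂ , refl , refl ∷ σ₁⊆α , σ₂⊆γ

contains⇒Occurs : ∀ π τ → T (contains π τ) → Occurs (T ∘ orderIso τ) π
contains⇒Occurs π τ c with find (any⁻ (orderIso τ) (subseqs π) c)
... | σ , σ∈ , iso = σ , ∈-subseqs⁻ π σ∈ , iso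

Occurs⇒contains : ∀ π τ → Occurs (T ∘ orderIso τ) π → T (contains π τ)
Occurs⇒contains π τ (σ , σ⊆π , iso) = any⁺ (orderIso τ) (lose (∈-subseqs⁺ σ⊆π) iso)

avoids⇔¬Occurs : ∀ {π τ} {P : List ℕ → Set} → (∀ σ → T (orderIso τ σ) ⇔ P σ) →
                 T (avoids π τ) ⇔ (¬ Occurs P π)
avoids⇔¬Occurs {π} {τ} iso⇔P = mk⇔
  (λ av occ → T-not⁻ av (Occurs⇒contains π τ (Occurs-map (Equivalence.from (iso⇔P _)) occ)))
  (λ ¬occ → T-not⁺ (¬occ ∘ Occurs-map (Equivalence.to (iso⇔P _)) ∘ contains⇒Occurs π τ))

-- orderIso (a ∷ u) (b ∷ v) unfolds to sameSide a b u v ∧ orderIso u v.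
sameSide : ℕ → ℕ → List ℕ → List ℕ → Bool
sameSide a b u v = all (λ { (x , y) → does ((a <ᵇ x) Bool.≟ (b <ᵇ y)) }) (zip u v)

orderIso-length : ∀ u v → T (orderIso u v) → length u ≡ length v
orderIso-length []      []      _   = refl
orderIso-length (a ∷ u) (b ∷ v) iso = cong suc (orderIso-length u v (proj₂ (T-∧⁻ {sameSide a b u v} iso)))

<ᵇ-transport : ∀ {a b x y} → T (does ((a <ᵇ x) Bool.≟ (b <ᵇ y))) → a < x → b < y
<ᵇ-transport {a} {b} {x} {y} same a<x = <ᵇ⇒< b y (subst T (≟-sound same) (<⇒<ᵇ a<x))

sameSide-above⁻ : ∀ c d u v → All (c <_) u → length u ≡ length v → T (sameSide c d u v) → All (d <_) v
sameSide-above⁻ c d []      []      _            _     _    = []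
sameSide-above⁻ c d (x ∷ u) (y ∷ v) (c<x ∷ c<u) |u|≡|v| same with T-∧⁻ same
... | same-x , same-u = <ᵇ-transport same-x c<x ∷ sameSide-above⁻ c d u v c<u (suc-injective |u|≡|v|) same-u

sameSide-above⁺ : ∀ c d u v → All (c <_) u → All (d <_) v → T (sameSide c d u v)
sameSide-above⁺ c d []      v       _            _            = tt
sameSide-above⁺ c d (x ∷ u) []      _            _            = tt
sameSide-above⁺ c d (x ∷ u) (y ∷ v) (c<x ∷ c<u) (d<y ∷ d<v) =
  T-∧⁺ (≟-complete (trans (<ᵇ-true c<x) (sym (<ᵇ-true d<y)))) (sameSide-above⁺ c d u v c<u d<v)

orderIso-increasing⁻ : ∀ u v → AllPairs _<_ u → T (orderIso u v) → AllPairs _<_ v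
orderIso-increasing⁻ []      []      _              _   = []
orderIso-increasing⁻ (a ∷ u) (b ∷ v) (a<u ∷ u-inc) iso with T-∧⁻ {sameSide a b u v} iso
... | same , iso′ =
  sameSide-above⁻ a b u v a<u (orderIso-length u v iso′) same ∷ orderIso-increasing⁻ u v u-inc iso′

orderIso-increasing⁺ : ∀ u v → AllPairs _<_ u → AllPairs _<_ v → length u ≡ length v → T (orderIso u v)
orderIso-increasing⁺ []      []      _              _              _       = tt
orderIso-increasing⁺ (a ∷ u) (b ∷ v) (a<u ∷ u-inc) (b<v ∷ v-inc) |u|≡|v| =
  T-∧⁺ (sameSide-above⁺ a b u v a<u b<v) (orderIso-increasing⁺ u v u-inc v-inc (suc-injective |u|≡|v|))

-- The non-strict inequalities here and in Is213k mirror orderIso, which only tests <ᵇ.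
Is132 : List ℕ → Set
Is132 (x ∷ y ∷ z ∷ []) = x < y × x < z × z ≤ y
Is132 _                = ⊥

orderIso-132 : ∀ σ → T (orderIso p132 σ) ⇔ Is132 σ
orderIso-132 σ = mk⇔ (to σ) (from σ)
  where
  to : ∀ σ → T (orderIso p132 σ) → Is132 σ
  to σ iso with orderIso-length p132 σ iso
  to (x ∷ y ∷ z ∷ []) iso | _ with x <ᵇ y in x<y | x <ᵇ z in x<z | y <ᵇ z in y<z
  ... | true | true | false = <ᵇ⇒< x y (subst T (sym x<y) tt) , <ᵇ⇒< x z (subst T (sym x<z) tt) ,
                              <ᵇ-false⇒≥ y z (subst (T ∘ not) (sym y<z) tt)
  to (x ∷ y ∷ z ∷ []) () | _ | true  | true  | true
  to (x ∷ y ∷ z ∷ []) () | _ | true  | false | _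
  to (x ∷ y ∷ z ∷ []) () | _ | false | _     | _
  from : ∀ σ → Is132 σ → T (orderIso p132 σ)
  from (x ∷ y ∷ z ∷ []) (x<y , x<z , z≤y) with x <ᵇ y in x<ᵇy | x <ᵇ z in x<ᵇz | y <ᵇ z in y<ᵇz
  ... | true  | true  | false = tt
  ... | false | _     | _     = subst T x<ᵇy (<⇒<ᵇ x<y)
  ... | true  | false | _     = subst T x<ᵇz (<⇒<ᵇ x<z)
  ... | true  | true  | true  = <⇒≱ (<ᵇ⇒< y z (subst T (sym y<ᵇz) tt)) z≤y

-- b ∷ a ∷ r is an occurrence of 2 1 3 ⋯ (j + 2).
Is213k : ℕ → List ℕ → Set
Is213k j (b ∷ a ∷ r) = a ≤ b × All (b <_) r × AllPairs _<_ r × length r ≡ j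
Is213k j _           = ⊥

private
  ι : ℕ → List ℕ
  ι j = map (λ i → i + 3) (upTo j)

  ι-increasing : ∀ j → AllPairs _<_ (ι j)
  ι-increasing j rewrite map-upTo (λ i → i + 3) j =
    AllPairs.applyUpTo⁺₁ (λ i → i + 3) j (λ i<i′ _ → +-monoˡ-< 3 i<i′)

  ι-above-2 : ∀ j → All (2 <_) (ι j)
  ι-above-2 j rewrite map-upTo (λ i → i + 3) j = All.applyUpTo⁺₁ (λ i → i + 3) j (λ {i} _ → m≤n+m 3 i)

  ι-length : ∀ j → length (ι j) ≡ j
  ι-length j = trans (length-map _ (upTo j)) (length-upTo j)

orderIso-213k : ∀ j σ → T (orderIso (p213k (suc (suc j))) σ) ⇔ Is213k j σ
orderIso-213k j σ = mk⇔ (to σ) (from σ)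
  where
  to : ∀ σ → T (orderIso (p213k (suc (suc j))) σ) → Is213k j σ
  to σ iso with orderIso-length (p213k (suc (suc j))) σ iso
  to (b ∷ a ∷ r) iso | |τ|≡|σ| with T-∧⁻ {sameSide 2 b (1 ∷ ι j) (a ∷ r)} iso
  ... | same₂ , iso′ with T-∧⁻ {does ((2 <ᵇ 1) Bool.≟ (b <ᵇ a))} same₂ | T-∧⁻ {sameSide 1 a (ι j) r} iso′
  ... | b≮a , b<r | _ , r-iso =
    <ᵇ-false⇒≥ b a (subst (T ∘ not) (≟-sound b≮a) tt) ,
    sameSide-above⁻ 2 b (ι j) r (ι-above-2 j) |ι|≡|r| b<r ,
    orderIso-increasing⁻ (ι j) r (ι-increasing j) r-iso ,
    trans (sym |ι|≡|r|) (ι-length j)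
    where
    |ι|≡|r| : length (ι j) ≡ length r
    |ι|≡|r| = suc-injective (suc-injective |τ|≡|σ|)
  from : ∀ σ → Is213k j σ → T (orderIso (p213k (suc (suc j))) σ)
  from (b ∷ a ∷ r) (a≤b , b<r , r-inc , |r|≡j) =
    T-∧⁺ (T-∧⁺ (≟-complete (sym (<ᵇ-false a≤b))) (sameSide-above⁺ 2 b (ι j) r (ι-above-2 j) b<r))
         (T-∧⁺ (sameSide-above⁺ 1 a (ι j) r (All.map (<-trans (s≤s z<s)) (ι-above-2 j))
                                            (All.map (<-≤-trans (s≤s a≤b)) b<r))
               (orderIso-increasing⁺ (ι j) r (ι-increasing j) r-inc (trans (ι-length j) (sym |r|≡j))))

Is213k-shorten : ∀ {j σ} → Is213k (suc j) σ → ∃ λ σ′ → σ′ ⊆ σ × Is213k j σ′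
Is213k-shorten {σ = b ∷ a ∷ c ∷ r} (a≤b , _ ∷ b<r , (_ ∷ r-inc) , |r|≡) =
  b ∷ a ∷ r , refl ∷ refl ∷ c ∷ʳ ⊆-refl , a≤b , b<r , r-inc , suc-injective |r|≡

-- Splitting an arrangement at its maximum

Above : List ℕ → List ℕ → Set
Above α β = ∀ {a b} → a ∈ α → b ∈ β → b < a

132-at-max : ∀ {α β a b M} → a ∈ α → b ∈ β → a < M → a < b → b ≤ M → Occurs Is132 (α ++ M ∷ β)
132-at-max a∈α b∈β a<M a<b b≤M =
  _ , Sublist.++⁺ (from∈ a∈α) (refl ∷ from∈ b∈β) , a<M , a<b , b≤M

stacked-arrangements : ∀ {lo n α β} → length α + length β ≡ n →
                       Unique α → Unique β → (∀ {x} → x ∈ α → x ∉ β) →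
                       All (InRange lo (lo + n)) α → All (InRange lo (lo + n)) β → Above α β →
                       Arrangement (lo + length β) (length α) α × Arrangement lo (length β) β
stacked-arrangements {lo} {n} {α} {β} |α|+|β|≡n uα uβ apart α-range β-range β<α = α-arr , β-arr
  where
  -- everything in α lies in (b, lo + n] for any b in β, which bounds b by counting
  β-low : ∀ {b} → b ∈ β → b ≤ lo + length β
  β-low {b} b∈β = +-cancelˡ-≤ (length α) _ _ (begin
    length α + b                ≤⟨ +-monoˡ-≤ b α-count ⟩
    (lo + n ∸ b) + b            ≡⟨ m∸n+n≡m b≤lo+n ⟩
    lo + n                      ≡⟨ cong (lo +_) |α|+|β|≡n ⟨
    lo + (length α + length β)  ≡⟨ x+[y+z]≡y+[x+z] lo (length α) (length β) ⟩
    length α + (lo + length β)  ∎)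
    where
    open ≤-Reasoning
    b≤lo+n = proj₂ (All.lookup β-range b∈β)
    α-count : length α ≤ lo + n ∸ b
    α-count = Unique-InRange-length uα (All.tabulate (λ a∈α → β<α a∈α b∈β , proj₂ (All.lookup α-range a∈α)))
    x+[y+z]≡y+[x+z] : ∀ x y z → x + (y + z) ≡ y + (x + z)
    x+[y+z]≡y+[x+z] = solve-∀
  β-arr : Arrangement lo (length β) β
  β-arr = record { length≡ = refl ; unique = uβ
                 ; inRange = All.tabulate (λ b∈β → proj₁ (All.lookup β-range b∈β) , β-low b∈β) }
  α-high : ∀ {a} → a ∈ α → lo + length β < a
  α-high {a} a∈α with lo + length β <? a
  ... | yes lo+m<a = lo+m<a
  ... | no  a≤lo+m = ⊥-elim (apart a∈α (Arrangement-∋ β-arr (proj₁ (All.lookup α-range a∈α) , ≮⇒≥ a≤lo+m)))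
  α-arr : Arrangement (lo + length β) (length α) α
  α-arr = record { length≡ = refl ; unique = uα
                 ; inRange = All.tabulate (λ {a} a∈α →
                               α-high a∈α , subst (a ≤_) lo+n≡ (proj₂ (All.lookup α-range a∈α))) }
    where
    lo+n≡ : lo + n ≡ lo + length β + length α
    lo+n≡ = trans (cong (lo +_) (trans (sym |α|+|β|≡n) (+-comm (length α) (length β)))) (sym (+-assoc lo _ _))

split-at-max : ∀ {lo n π} → Arrangement lo (suc n) π → ¬ Occurs Is132 π →
  ∃₂ λ α β → π ≡ α ++ (lo + suc n) ∷ β × length α + length β ≡ n ×
             Arrangement (lo + length β) (length α) α × Arrangement lo (length β) β
split-at-max {lo} {n} {π} arr ¬132 with ∈-∃++ (Arrangement-∋ arr (m<m+n lo z<s , ≤-refl))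
... | α , β , refl = α , β , refl , |α|+|β|≡n ,
                     stacked-arrangements |α|+|β|≡n uα uβ (λ x∈α → α∩M∷β=∅ x∈α ∘ there)
                                          α-range β-range β<α
  where
  M = lo + suc n
  parts = Unique-++⁻ α (unique arr)
  uα = proj₁ parts
  α∩M∷β=∅ = proj₂ (proj₂ parts)
  M∉β : M ∉ β
  M∉β with proj₁ (proj₂ parts)
  ... | M≢β ∷ _ = λ M∈β → All.lookup M≢β M∈β refl
  uβ : Unique β
  uβ with proj₁ (proj₂ parts)
  ... | _ ∷ uβ = uβ
  |α|+|β|≡n : length α + length β ≡ n
  |α|+|β|≡n = suc-injective (trans (cong suc (sym (length-++ α))) (trans (sym (length-++-sucʳ α M β)) (length≡ arr)))
  below-M : ∀ {x} → InRange lo M x → x ≢ M → InRange lo (lo + n) x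
  below-M {x} (lo<x , x≤M) x≢M = lo<x , ≤-pred (subst (x <_) (+-suc lo n) (≤∧≢⇒< x≤M x≢M))
  α-range : All (InRange lo (lo + n)) α
  α-range = All.tabulate (λ {x} x∈α →
    below-M (All.lookup (inRange arr) (∈-++⁺ˡ x∈α)) (λ { refl → α∩M∷β=∅ x∈α (here refl) }))
  β-range : All (InRange lo (lo + n)) β
  β-range = All.tabulate (λ {x} x∈β →
    below-M (All.lookup (inRange arr) (∈-++⁺ʳ α (there x∈β))) (λ { refl → M∉β x∈β }))
  -- a below b would make a M b an occurrence of 132
  β<α : Above α β
  β<α {a} {b} a∈α b∈β with <-cmp b a
  ... | tri< b<a _ _ = b<a
  ... | tri≈ _ refl _ = ⊥-elim (α∩M∷β=∅ a∈α (there b∈β))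
  ... | tri> _ _ a<b = ⊥-elim (¬132 (132-at-max a∈α b∈β (<M (proj₂ (All.lookup α-range a∈α))) a<b
                                                    (<⇒≤ (<M (proj₂ (All.lookup β-range b∈β))))))
    where
    <M : ∀ {x} → x ≤ lo + n → x < M
    <M {x} x≤lo+n = subst (x <_) (sym (+-suc lo n)) (s≤s x≤lo+n)

upper-block-<max : ∀ {lo la m n α} → la + m ≡ n → Arrangement (lo + m) la α → All (_< lo + suc n) α
upper-block-<max {lo} {la} {m} {n} la+m≡n α-arr = All.map below (inRange α-arr)
  where
  lo+m+la≡lo+n : lo + m + la ≡ lo + n
  lo+m+la≡lo+n = trans (+-assoc lo m la) (cong (lo +_) (trans (+-comm m la) la+m≡n))
  below : ∀ {x} → InRange (lo + m) (lo + m + la) x → x < lo + suc n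
  below {x} (_ , x≤) = subst (x <_) (sym (+-suc lo n)) (s≤s (subst (x ≤_) lo+m+la≡lo+n x≤))

lower-block-<max : ∀ {lo la m n β} → la + m ≡ n → Arrangement lo m β → All (_< lo + suc n) β
lower-block-<max {lo} {la} {m} {n} la+m≡n β-arr = All.map below (inRange β-arr)
  where
  below : ∀ {x} → InRange lo (lo + m) x → x < lo + suc n
  below {x} (_ , x≤) =
    subst (x <_) (sym (+-suc lo n)) (s≤s (≤-trans x≤ (+-monoʳ-≤ lo (subst (m ≤_) la+m≡n (m≤n+m m la)))))

blocks-above : ∀ {lo la m α β} → Arrangement (lo + m) la α → Arrangement lo m β → Above α β
blocks-above α-arr β-arr a∈α b∈β =
  ≤-<-trans (proj₂ (All.lookup (inRange β-arr) b∈β)) (proj₁ (All.lookup (inRange α-arr) a∈α))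

join-arrangement : ∀ {lo la m n α β} → la + m ≡ n → Arrangement (lo + m) la α → Arrangement lo m β →
                   Arrangement lo (suc n) (α ++ (lo + suc n) ∷ β)
join-arrangement {lo} {la} {m} {n} {α} {β} la+m≡n α-arr β-arr = record
  { length≡ = begin
      length (α ++ M ∷ β)  ≡⟨ length-++ α ⟩
      la′ + suc m′         ≡⟨ +-suc la′ m′ ⟩
      suc (la′ + m′)       ≡⟨ cong suc (cong₂ _+_ (length≡ α-arr) (length≡ β-arr)) ⟩
      suc (la + m)         ≡⟨ cong suc la+m≡n ⟩
      suc n                ∎
  ; unique  = Unique.++⁺ (unique α-arr)
                         (All.tabulate (λ y∈β M≡y → <-irrefl (sym M≡y) (All.lookup β<M y∈β)) ∷ unique β-arr)
                         apart
  ; inRange = All.++⁺ (All.tabulate (λ x∈α → ≤-<-trans (m≤m+n lo m) (proj₁ (All.lookup (inRange α-arr) x∈α)) ,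
                                               <⇒≤ (All.lookup α<M x∈α)))
                      ((m<m+n lo z<s , ≤-refl) ∷
                       All.tabulate (λ y∈β → proj₁ (All.lookup (inRange β-arr) y∈β) , <⇒≤ (All.lookup β<M y∈β)))
  }
  where
  open ≡-Reasoning
  M = lo + suc n
  la′ = length α
  m′ = length β
  α<M = upper-block-<max la+m≡n α-arr
  β<M = lower-block-<max la+m≡n β-arr
  apart : ∀ {x} → ¬ (x ∈ α × x ∈ M ∷ β)
  apart (x∈α , here refl)  = <-irrefl refl (All.lookup α<M x∈α)
  apart (x∈α , there x∈β) = <-irrefl refl (blocks-above α-arr β-arr x∈α x∈β)

module _ {α β : List ℕ} {M : ℕ} (α<M : All (_< M) α) (β<M : All (_< M) β) (β<α : Above α β) where

  ¬132-join : ¬ Occurs Is132 α → ¬ Occurs Is132 β → ¬ Occurs Is132 (α ++ M ∷ β)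
  ¬132-join ¬α ¬β (σ , σ⊆ , occ) with ⊆-++-split α σ⊆
  ... | σ₁ , σ₂ , refl , σ₁⊆α , σ₂⊆Mβ = occurrence σ₁ σ₂ σ₁⊆α σ₂⊆Mβ occ
    where
    occurrence : ∀ σ₁ σ₂ → σ₁ ⊆ α → σ₂ ⊆ M ∷ β → ¬ Is132 (σ₁ ++ σ₂)
    occurrence [] σ₂ _ (.M ∷ʳ σ₂⊆β) occ = ¬β (σ₂ , σ₂⊆β , occ)
    occurrence [] (.M ∷ y ∷ _ ∷ []) _ (refl ∷ σ₂⊆β) (M<y , _) =
      <-asym M<y (All.lookup β<M (lookup σ₂⊆β (here refl)))
    occurrence (x ∷ []) (y ∷ _ ∷ []) σ₁⊆α (.M ∷ʳ σ₂⊆β) (x<y , _) =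
      <-asym x<y (β<α (lookup σ₁⊆α (here refl)) (lookup σ₂⊆β (here refl)))
    occurrence (x ∷ []) (.M ∷ z ∷ []) σ₁⊆α (refl ∷ σ₂⊆β) (_ , x<z , _) =
      <-asym x<z (β<α (lookup σ₁⊆α (here refl)) (lookup σ₂⊆β (here refl)))
    occurrence (x ∷ _ ∷ []) (z ∷ []) σ₁⊆α (.M ∷ʳ σ₂⊆β) (_ , x<z , _) =
      <-asym x<z (β<α (lookup σ₁⊆α (here refl)) (lookup σ₂⊆β (here refl)))
    occurrence (_ ∷ y ∷ []) (.M ∷ []) σ₁⊆α (refl ∷ _) (_ , _ , M≤y) =
      <⇒≱ (All.lookup α<M (lookup σ₁⊆α (there (here refl)))) M≤y
    occurrence (_ ∷ _ ∷ _ ∷ []) [] σ₁⊆α _ occ = ¬α (_ , σ₁⊆α , occ)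

  ¬213k-join : ∀ {j} → ¬ Occurs (Is213k j) α → ¬ Occurs (Is213k (suc j)) β → ¬ Occurs (Is213k (suc j)) (α ++ M ∷ β)
  ¬213k-join {j} ¬α ¬β (σ , σ⊆ , occ) with ⊆-++-split α σ⊆
  ... | σ₁ , σ₂ , refl , σ₁⊆α , σ₂⊆Mβ = occurrence σ₁ σ₂ σ₁⊆α σ₂⊆Mβ occ
    where
    occurrence : ∀ σ₁ σ₂ → σ₁ ⊆ α → σ₂ ⊆ M ∷ β → ¬ Is213k (suc j) (σ₁ ++ σ₂)
    occurrence [] σ₂ _ (.M ∷ʳ σ₂⊆β) occ = ¬β (σ₂ , σ₂⊆β , occ)
    occurrence [] (.M ∷ _ ∷ _ ∷ _) _ (refl ∷ σ₂⊆β) (_ , M<c ∷ _ , _) =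
      <-asym M<c (All.lookup β<M (lookup σ₂⊆β (there (here refl))))
    occurrence (b ∷ []) (_ ∷ _ ∷ _) σ₁⊆α (.M ∷ʳ σ₂⊆β) (_ , b<c ∷ _ , _) =
      <-asym b<c (β<α (lookup σ₁⊆α (here refl)) (lookup σ₂⊆β (there (here refl))))
    occurrence (b ∷ []) (.M ∷ _) σ₁⊆α (refl ∷ _) (M≤b , _) =
      <⇒≱ (All.lookup α<M (lookup σ₁⊆α (here refl))) M≤b
    occurrence (b ∷ a ∷ r) [] σ₁⊆α _ occ
      rewrite ++-identityʳ r with Is213k-shorten occ
    ... | σ′ , σ′⊆ , occ′ = ¬α (σ′ , ⊆-trans σ′⊆ σ₁⊆α , occ′)
    occurrence (b ∷ a ∷ r) (c ∷ _) σ₁⊆α (.M ∷ʳ σ₂⊆β) (_ , b<r++c , _) =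
      <-asym (All.lookup b<r++c (∈-++⁺ʳ r (here refl)))
             (β<α (lookup σ₁⊆α (here refl)) (lookup σ₂⊆β (here refl)))
    occurrence (b ∷ a ∷ r) (.M ∷ d ∷ _) σ₁⊆α (refl ∷ σ₂⊆β) (_ , b<r++Md , _) =
      <-asym (All.lookup b<r++Md (∈-++⁺ʳ r (there (here refl))))
             (β<α (lookup σ₁⊆α (here refl)) (lookup σ₂⊆β (here refl)))
    occurrence (b ∷ a ∷ r) (.M ∷ []) σ₁⊆α (refl ∷ _) (a≤b , b<r++M , r++M-inc , |r++M|≡) =
      ¬α (b ∷ a ∷ r , σ₁⊆α , a≤b , All.++⁻ˡ r b<r++M , AllPairs-++⁻ˡ r r++M-inc ,
          suc-injective (trans (+-comm 1 (length r)) (trans (sym (length-++ r)) |r++M|≡)))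
      where
      AllPairs-++⁻ˡ : ∀ {R : ℕ → ℕ → Set} xs {ys} → AllPairs R (xs ++ ys) → AllPairs R xs
      AllPairs-++⁻ˡ []       _              = []
      AllPairs-++⁻ˡ (x ∷ xs) (x~ ∷ xs++ys) = All.++⁻ˡ xs x~ ∷ AllPairs-++⁻ˡ xs xs++ys

¬21-snoc : ∀ {α M} → All (_< M) α → ¬ Occurs (Is213k 0) α → ¬ Occurs (Is213k 0) (α ++ M ∷ [])
¬21-snoc {α} {M} α<M ¬α (σ , σ⊆ , occ) with ⊆-++-split α σ⊆
... | σ₁ , σ₂ , refl , σ₁⊆α , σ₂⊆M = occurrence σ₁ σ₂ σ₁⊆α σ₂⊆M occ
  where
  occurrence : ∀ σ₁ σ₂ → σ₁ ⊆ α → σ₂ ⊆ M ∷ [] → ¬ Is213k 0 (σ₁ ++ σ₂)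
  occurrence []          (_ ∷ _ ∷ _) _     (_ ∷ ())
  occurrence []          (_ ∷ _ ∷ _) _     (_ ∷ʳ ())
  occurrence (b ∷ [])    (.M ∷ [])  σ₁⊆α (refl ∷ _) (M≤b , _) =
    <⇒≱ (All.lookup α<M (lookup σ₁⊆α (here refl))) M≤b
  occurrence (_ ∷ _ ∷ []) []        σ₁⊆α _           occ = ¬α (_ , σ₁⊆α , occ)
  occurrence (_ ∷ _ ∷ []) (_ ∷ _)   _     _           (_ , _ , _ , ())
  occurrence (_ ∷ _ ∷ _ ∷ _) _      _     _           (_ , _ , _ , ())

213k-extend : ∀ {j α M} β → All (_< M) α → Occurs (Is213k j) α → Occurs (Is213k (suc j)) (α ++ M ∷ β)
213k-extend β α<M (b ∷ a ∷ r , σ⊆α , a≤b , b<r , r-inc , |r|≡j) =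
  b ∷ a ∷ r ++ _ ∷ [] ,
  Sublist.++⁺ σ⊆α (refl ∷ minimum β) ,
  a≤b ,
  All.++⁺ b<r (All.lookup α<M (lookup σ⊆α (here refl)) ∷ []) ,
  AllPairs-snoc r-inc (All.lookup α<M ∘ lookup σ⊆α ∘ there ∘ there) ,
  trans (length-++ r) (trans (+-comm (length r) 1) (cong suc |r|≡j))
  where
  AllPairs-snoc : ∀ {r M} → AllPairs _<_ r → (∀ {x} → x ∈ r → x < M) → AllPairs _<_ (r ++ M ∷ [])
  AllPairs-snoc []               _   = [] ∷ []
  AllPairs-snoc (x<r ∷ r-inc) r<M = All.++⁺ x<r (r<M (here refl) ∷ []) ∷ AllPairs-snoc r-inc (r<M ∘ there)

21-at-max : ∀ α {M b} β → b ≤ M → Occurs (Is213k 0) (α ++ M ∷ b ∷ β)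
21-at-max α β b≤M = _ , Sublist.++⁺ˡ α (refl ∷ refl ∷ minimum β) , b≤M , [] , [] , refl

-- Dumont arrangements

isEven-+ˡ : ∀ lo x → T (isEven lo) → isEven (lo + x) ≡ isEven x
isEven-+ˡ lo x lo-even = cong (_≡ᵇ 0) (begin
  (lo + x) % 2             ≡⟨ %-distribˡ-+ lo x 2 ⟩
  (lo % 2 + x % 2) % 2     ≡⟨ cong (λ r → (r + x % 2) % 2) (≡ᵇ⇒≡ (lo % 2) 0 lo-even) ⟩
  x % 2 % 2                ≡⟨ m%n%n≡m%n x 2 ⟩
  x % 2                    ∎)
  where open ≡-Reasoning

isEven-suc-suc : ∀ x → isEven (suc (suc x)) ≡ isEven x
isEven-suc-suc x = cong (_≡ᵇ 0) (trans (cong (_% 2) (+-comm 2 x)) ([m+n]%n≡m%n x 2))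

isEven-double : ∀ t → T (isEven (double t))
isEven-double zero    = tt
isEven-double (suc t) = subst T (sym (isEven-suc-suc (double t))) (isEven-double t)

isEven-+-double : ∀ lo s → T (isEven lo) → T (isEven (lo + double s))
isEven-+-double lo s lo-even = subst T (sym (isEven-+ˡ lo (double s) lo-even)) (isEven-double s)

isOdd-suc-double : ∀ t → T (not (isEven (suc (double t))))
isOdd-suc-double zero    = tt
isOdd-suc-double (suc t) = subst (T ∘ not) (sym (isEven-suc-suc (suc (double t)))) (isOdd-suc-double t)

dumont-++-max : ∀ α {x β} → All (_< x) α → dumont (α ++ x ∷ β) ≡ dumont α ∧ dumont (x ∷ β)
dumont-++-max []                   _              = refl
dumont-++-max (a ∷ [])    {x}      (a<x ∷ [])     with isEven a
... | true  rewrite <ᵇ-false {x} (<⇒≤ a<x) = refl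
... | false rewrite <ᵇ-true a<x          = refl
dumont-++-max (a ∷ b ∷ α) {x} {β} (_ ∷ bα<x) =
  trans (cong (step ∧_) (dumont-++-max (b ∷ α) bα<x)) (sym (∧-assoc step (dumont (b ∷ α)) (dumont (x ∷ β))))
  where
  step = if isEven a then b <ᵇ a else a <ᵇ b

dumont-max-∷ : ∀ {M b} β → b < M → dumont (M ∷ b ∷ β) ≡ isEven M ∧ dumont (b ∷ β)
dumont-max-∷ {M} β b<M with isEven M
... | true  rewrite <ᵇ-true b<M           = refl
... | false rewrite <ᵇ-false {M} (<⇒≤ b<M) = refl

dumont-tail : ∀ {M} β → All (_< M) β → T (dumont (M ∷ β)) → T (dumont β)
dumont-tail []      _         _  = tt
dumont-tail (b ∷ β) (b<M ∷ _) dM = proj₂ (T-∧⁻ (subst T (dumont-max-∷ β b<M) dM))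

-- In a Dumont permutation an even entry is never last, so it is followed by a smaller one.
dumont-even-descent : ∀ α {v} → T (dumont α) → v ∈ α → T (isEven v) → ∃ λ w → w ∈ α × w < v
dumont-even-descent (a ∷ [])    dα (here refl) a-even = ⊥-elim (T-not⁻ dα a-even)
dumont-even-descent (a ∷ b ∷ α) dα (here refl) a-even =
  b , there (here refl) , <ᵇ⇒< b a (proj₁ (T-∧⁻ (subst T step≡ dα)))
  where
  step≡ : dumont (a ∷ b ∷ α) ≡ (b <ᵇ a) ∧ dumont (b ∷ α)
  step≡ = cong (λ e → (if e then b <ᵇ a else a <ᵇ b) ∧ dumont (b ∷ α)) (Equivalence.to T-≡ a-even)
dumont-even-descent (a ∷ b ∷ α) dα (there v∈) v-even with dumont-even-descent (b ∷ α) (proj₂ (T-∧⁻ dα)) v∈ v-even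
... | w , w∈ , w<v = w , there w∈ , w<v

Good : ℕ → List ℕ → Set
Good j π = T (dumont π) × ¬ Occurs Is132 π × ¬ Occurs (Is213k j) π

Good-[] : ∀ j → Good j []
Good-[] j = tt , (λ { (_ , [] , ()) }) , (λ { (_ , [] , ()) })

Good-join : ∀ {j lo la m n α β} → la + m ≡ n → Arrangement (lo + m) la α → Arrangement lo m β →
            Good (suc j) (α ++ (lo + suc n) ∷ β) ⇔ (Good j α × Good (suc j) β × T (dumont (lo + suc n ∷ β)))
Good-join {j} {lo} {n = n} {α} {β} la+m≡n α-arr β-arr = mk⇔ split join
  where
  M = lo + suc n
  α<M = upper-block-<max la+m≡n α-arr
  β<M = lower-block-<max la+m≡n β-arr
  β<α = blocks-above α-arr β-arr
  α⊆ : α ⊆ α ++ M ∷ β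
  α⊆ = Sublist.++⁺ʳ (M ∷ β) ⊆-refl
  β⊆ : β ⊆ α ++ M ∷ β
  β⊆ = Sublist.++⁺ˡ α (M ∷ʳ ⊆-refl)
  split : Good (suc j) (α ++ M ∷ β) → Good j α × Good (suc j) β × T (dumont (M ∷ β))
  split (dπ , ¬132 , ¬213k) with T-∧⁻ (subst T (dumont-++-max α α<M) dπ)
  ... | dα , dMβ = (dα , ¬132 ∘ Occurs-⊆ α⊆ , ¬213k ∘ 213k-extend β α<M)
                 , (dumont-tail β β<M dMβ , ¬132 ∘ Occurs-⊆ β⊆ , ¬213k ∘ Occurs-⊆ β⊆)
                 , dMβ
  join : Good j α × Good (suc j) β × T (dumont (M ∷ β)) → Good (suc j) (α ++ M ∷ β)
  join ((dα , ¬132α , ¬213kα) , (_ , ¬132β , ¬213kβ) , dMβ) =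
    subst T (sym (dumont-++-max α α<M)) (T-∧⁺ dα dMβ) ,
    ¬132-join α<M β<M β<α ¬132α ¬132β ,
    ¬213k-join α<M β<M β<α ¬213kα ¬213kβ

Good₀-snoc : ∀ {α M} → All (_< M) α → Good 0 (α ++ M ∷ []) ⇔ (Good 0 α × T (not (isEven M)))
Good₀-snoc {α} {M} α<M = mk⇔ split join
  where
  split : Good 0 (α ++ M ∷ []) → Good 0 α × T (not (isEven M))
  split (dπ , ¬132 , ¬21) with T-∧⁻ (subst T (dumont-++-max α α<M) dπ)
  ... | dα , M-odd = (dα , ¬132 ∘ Occurs-⊆ α⊆ , ¬21 ∘ Occurs-⊆ α⊆) , M-odd
    where
    α⊆ : α ⊆ α ++ M ∷ []
    α⊆ = Sublist.++⁺ʳ (M ∷ []) ⊆-refl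
  join : Good 0 α × T (not (isEven M)) → Good 0 (α ++ M ∷ [])
  join ((dα , ¬132α , ¬21α) , M-odd) =
    subst T (sym (dumont-++-max α α<M)) (T-∧⁺ dα M-odd) ,
    ¬132-join α<M [] (λ _ ()) ¬132α (λ { (_ , [] , ()) }) ,
    ¬21-snoc α<M ¬21α

-- Enumerating the good arrangements

-- The good arrangements of (lo, lo + len], built by placing the maximum; the fuel f only has
-- to exceed len, and lo has to be even for the parity of the maximum to be that of len.
goodArrangements : (f j lo len : ℕ) → List (List ℕ)
goodArrangementsWithMax : (f j lo n : ℕ) → Parity n → List (List ℕ)
goodSplits : (f j lo t s : ℕ) → List (List ℕ)

goodArrangements zero    j       lo len           = []
goodArrangements (suc f) j       lo zero          = [] ∷ []
goodArrangements (suc f) zero    lo (suc zero)    = (lo + 1 ∷ []) ∷ []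
goodArrangements (suc f) zero    lo (suc (suc n)) = []
goodArrangements (suc f) (suc j) lo (suc n)       = goodArrangementsWithMax f j lo n (parity n)

goodArrangementsWithMax f j lo _ (even t) = map (_++ lo + suc (double t) ∷ []) (goodArrangements f j lo (double t))
goodArrangementsWithMax f j lo _ (odd t)  =
  map (lo + suc (suc (double t)) ∷_) (goodArrangements f (suc j) lo (suc (double t))) ++
  concatMap (goodSplits f j lo t) (upTo (suc t))

goodSplits f j lo t zero    = []
goodSplits f j lo t (suc s) =
  cartesianProductWith (λ α β → α ++ lo + suc (suc (double t)) ∷ β)
                       (goodArrangements f j (lo + double (suc s)) (suc (double (t ∸ suc s))))
                       (goodArrangements f (suc j) lo (double (suc s)))

join-good : ∀ {j lo la m n α β} → la + m ≡ n → Arrangement (lo + m) la α → Good j α →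
            Arrangement lo m β → Good (suc j) β → T (dumont (lo + suc n ∷ β)) →
            Arrangement lo (suc n) (α ++ lo + suc n ∷ β) × Good (suc j) (α ++ lo + suc n ∷ β)
join-good la+m≡n α-arr α-good β-arr β-good dMβ =
  join-arrangement la+m≡n α-arr β-arr , Equivalence.from (Good-join la+m≡n α-arr β-arr) (α-good , β-good , dMβ)

odd-max-dumont : ∀ lo t → T (isEven lo) → T (dumont (lo + suc (double t) ∷ []))
odd-max-dumont lo t lo-even = subst (T ∘ not) (sym (isEven-+ˡ lo (suc (double t)) lo-even)) (isOdd-suc-double t)

even-max-dumont : ∀ lo t {k β} → T (isEven lo) → All (_< lo + suc (suc (double t))) β → length β ≡ suc k →
                  T (dumont β) → T (dumont (lo + suc (suc (double t)) ∷ β))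
even-max-dumont lo t {β = b ∷ β} lo-even (b<M ∷ _) _ dβ =
  subst T (sym (dumont-max-∷ β b<M)) (T-∧⁺ M-even dβ)
  where
  M-even : T (isEven (lo + double (suc t)))
  M-even = subst T (sym (isEven-+ˡ lo (double (suc t)) lo-even)) (isEven-double (suc t))

Sound : ℕ → Set
Sound f = ∀ {j lo len π} → T (isEven lo) → π ∈ goodArrangements f j lo len → Arrangement lo len π × Good j π

sound-withMax : ∀ {f} → Sound f → ∀ {j lo} n (p : Parity n) {π} → T (isEven lo) →
                π ∈ goodArrangementsWithMax f j lo n p →
            Arrangement lo (suc n) π × Good (suc j) π
sound-withMax ih {j} {lo} _ (even t) lo-even π∈ with ∈-map⁻ _ π∈
... | α , α∈ , refl with ih lo-even α∈
... | α-arr , α-good =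
  join-good (+-identityʳ (double t)) (Arrangement-cong (sym (+-identityʳ lo)) refl α-arr) α-good
            empty-arrangement (Good-[] (suc j)) (odd-max-dumont lo t lo-even)
sound-withMax {f} ih {j} {lo} _ (odd t) lo-even π∈ with ∈-++⁻ (map _ (goodArrangements f (suc j) lo (suc (double t)))) π∈
... | inj₁ π∈head with ∈-map⁻ _ π∈head
...   | β , β∈ , refl with ih lo-even β∈
...   | β-arr , β-good@(dβ , _) =
  join-good refl empty-arrangement (Good-[] j) β-arr β-good
            (even-max-dumont lo t lo-even (lower-block-<max {la = 0} refl β-arr) (length≡ β-arr) dβ)
sound-withMax {f} ih {j} {lo} _ (odd t) lo-even π∈ | inj₂ π∈splits
  with find (∈-concatMap⁻ (goodSplits f j lo t) {upTo (suc t)} π∈splits)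
... | zero , _ , ()
... | suc s , s∈ , π∈split
  with ∈-cartesianProductWith⁻ _ (goodArrangements f j (lo + double (suc s)) (suc (double (t ∸ suc s))))
                                 (goodArrangements f (suc j) lo (double (suc s))) π∈split
... | α , β , α∈ , β∈ , refl with ih (isEven-+-double lo (suc s) lo-even) α∈ | ih lo-even β∈
... | α-arr , α-good | β-arr , β-good@(dβ , _) =
  join-good |α|+|β|≡ α-arr α-good β-arr β-good
            (even-max-dumont lo t lo-even (lower-block-<max {la = suc (double (t ∸ suc s))} |α|+|β|≡ β-arr)
                             (length≡ β-arr) dβ)
  where
  |α|+|β|≡ : suc (double (t ∸ suc s)) + double (suc s) ≡ suc (double t)
  |α|+|β|≡ = split-length (≤-pred (∈-upTo⁻ s∈))

sound : ∀ f → Sound f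
sound (suc f) {len = zero} _ (here refl) = empty-arrangement , Good-[] _
sound (suc f) {zero} {lo} {suc zero} lo-even (here refl) =
  join-arrangement refl empty-arrangement empty-arrangement ,
  Equivalence.from (Good₀-snoc []) (Good-[] 0 , odd-max-dumont lo 0 lo-even)
sound (suc f) {suc j} {len = suc n} lo-even π∈ = sound-withMax (sound f) n (parity n) lo-even π∈

-- The smallest entry lo + m + 1 of the upper block would be even if m were odd, but an even entry
-- of a Dumont permutation has a smaller entry after it.
upper-block-offset-even : ∀ lo m {la α} → T (isEven lo) → Arrangement (lo + m) (suc la) α → T (dumont α) →
                          ∃ λ s → m ≡ double s
upper-block-offset-even lo m {la} {α} lo-even α-arr dα with parity m
... | even s = s , refl
... | odd u  =
  let w , w∈α , w<v = dumont-even-descent α dα v∈α v-even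
  in ⊥-elim (<⇒≱ w<v (proj₁ (All.lookup (inRange α-arr) w∈α)))
  where
  v = suc (lo + suc (double u))
  v∈α : v ∈ α
  v∈α = Arrangement-∋ α-arr (≤-refl , subst (v ≤_) (sym (+-suc (lo + suc (double u)) la)) (s≤s (m≤m+n _ la)))
  v-even : T (isEven v)
  v-even = subst (T ∘ isEven) (+-suc lo (suc (double u))) (isEven-+-double lo (suc u) lo-even)

Complete : ℕ → Set
Complete f = ∀ {j lo len π} → T (isEven lo) → len < f → Arrangement lo len π → Good j π →
             π ∈ goodArrangements f j lo len

-- When j = 0 anything after the maximum forms a 21 with it, so the maximum is last and odd;
-- a part of length ≥ 2 before it is excluded by the (empty) enumeration itself.
complete₀-withMax : ∀ {f} → Complete f → ∀ {lo n} α β → T (isEven lo) → n < f → length α + length β ≡ n →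
                Arrangement (lo + length β) (length α) α → Arrangement lo (length β) β →
                Good 0 (α ++ lo + suc n ∷ β) → α ++ lo + suc n ∷ β ∈ goodArrangements (suc f) 0 lo (suc n)
complete₀-withMax ih α (b ∷ β) lo-even n<f |α|+|β|≡n α-arr β-arr (_ , _ , ¬21) =
  ⊥-elim (¬21 (21-at-max α β (<⇒≤ (All.lookup (lower-block-<max |α|+|β|≡n β-arr) (here refl)))))
complete₀-withMax {f} ih {lo} {n} α [] lo-even n<f |α|+0≡n α-arr β-arr good
  with Equivalence.to (Good₀-snoc (upper-block-<max |α|+0≡n α-arr)) good
... | α-good , M-odd with n | α | |α|+0≡n
...   | zero        | []    | _       = here refl
...   | suc zero    | _     | _       = ⊥-elim (T-not⁻ M-odd (isEven-+-double lo 1 lo-even))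
...   | suc (suc k) | _     | |α|+0≡
  with f | ih lo-even n<f (Arrangement-cong (+-identityʳ lo) (trans (sym (+-identityʳ _)) |α|+0≡) α-arr) α-good
...     | suc _ | ()

complete-withMax : ∀ {f} → Complete f → ∀ {j lo} n (p : Parity n) α β → T (isEven lo) → n < f →
               length α + length β ≡ n → Arrangement (lo + length β) (length α) α → Arrangement lo (length β) β →
               Good j α → Good (suc j) β → T (dumont (lo + suc n ∷ β)) →
               α ++ lo + suc n ∷ β ∈ goodArrangementsWithMax f j lo n p
complete-withMax ih {lo = lo} _ (even t) α [] lo-even n<f |α|+0≡n α-arr _ α-good _ _ =
  ∈-map⁺ _ (ih lo-even n<f (Arrangement-cong (+-identityʳ lo) (trans (sym (+-identityʳ _)) |α|+0≡n) α-arr) α-good)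
complete-withMax ih {lo = lo} _ (even t) α (b ∷ β) lo-even _ |α|+|β|≡n α-arr β-arr _ _ dMβ =
  ⊥-elim (T-not⁻ (odd-max-dumont lo t lo-even) (proj₁ (T-∧⁻ (subst T (dumont-max-∷ β b<M) dMβ))))
  where b<M = All.lookup (lower-block-<max |α|+|β|≡n β-arr) (here refl)
complete-withMax ih {lo = lo} _ (odd t) α [] lo-even _ _ _ _ _ _ dM =
  ⊥-elim (T-not⁻ dM (isEven-+-double lo (suc t) lo-even))
complete-withMax ih _ (odd t) [] (b ∷ β) lo-even n<f |β|≡n _ β-arr _ β-good _ =
  ∈-++⁺ˡ (∈-map⁺ _ (ih lo-even n<f (Arrangement-cong refl |β|≡n β-arr) β-good))
complete-withMax {f} ih {j} {lo} _ (odd t) (a ∷ α) (b ∷ β) lo-even n<f |α|+|β|≡n α-arr β-arr α-good β-good _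
  with upper-block-offset-even lo (length (b ∷ β)) lo-even α-arr (proj₁ α-good)
... | suc s , |β|≡ =
  ∈-++⁺ʳ _ (∈-concatMap⁺ (goodSplits f j lo t) (lose (∈-upTo⁺ (s≤s s<t)) (∈-cartesianProductWith⁺ _ α∈ β∈)))
  where
  |α|+2s≡2t : length α + double (suc s) ≡ double t
  |α|+2s≡2t = suc-injective (trans (cong (suc (length α) +_) (sym |β|≡)) |α|+|β|≡n)
  s<t : suc s ≤ t
  s<t = double-cancel-≤ (subst (double (suc s) ≤_) |α|+2s≡2t (m≤n+m _ (length α)))
  |α|≡ : length (a ∷ α) ≡ suc (double (t ∸ suc s))
  |α|≡ = cong suc (+-cancelʳ-≡ _ _ _ (trans |α|+2s≡2t (sym (double-∸-+ s<t))))
  α∈ : a ∷ α ∈ goodArrangements f j (lo + double (suc s)) (suc (double (t ∸ suc s)))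
  α∈ = ih (isEven-+-double lo (suc s) lo-even)
          (subst (_< f) |α|≡ (≤-<-trans (subst (length (a ∷ α) ≤_) |α|+|β|≡n (m≤m+n _ _)) n<f))
          (Arrangement-cong (cong (lo +_) |β|≡) |α|≡ α-arr) α-good
  β∈ : b ∷ β ∈ goodArrangements f (suc j) lo (double (suc s))
  β∈ = ih lo-even
          (subst (_< f) |β|≡ (≤-<-trans (subst (length (b ∷ β) ≤_) |α|+|β|≡n (m≤n+m _ (length (a ∷ α)))) n<f))
          (Arrangement-cong refl |β|≡ β-arr) β-good

complete : ∀ f → Complete f
complete (suc f) {len = zero} {[]} _ _ _ _ = here refl
complete (suc f) {j} {lo} {suc n} lo-even (s≤s n<f) arr good with split-at-max arr (proj₁ (proj₂ good))
... | α , β , refl , |α|+|β|≡n , α-arr , β-arr with j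
...   | zero  = complete₀-withMax (complete f) α β lo-even n<f |α|+|β|≡n α-arr β-arr good
...   | suc j =
  let α-good , β-good , dMβ = Equivalence.to (Good-join |α|+|β|≡n α-arr β-arr) good
  in complete-withMax (complete f) n (parity n) α β lo-even n<f |α|+|β|≡n α-arr β-arr α-good β-good dMβ

goodArrangements-unique : ∀ f {j lo len} → T (isEven lo) → Unique (goodArrangements f j lo len)
goodArrangements-unique zero                                    _       = []
goodArrangements-unique (suc f) {len = zero}                    _       = [] ∷ []
goodArrangements-unique (suc f) {zero} {len = suc zero}         _       = [] ∷ []
goodArrangements-unique (suc f) {zero} {len = suc (suc n)}      _       = []
goodArrangements-unique (suc f) {suc j} {lo} {suc n} lo-even with parity n
... | even t = Unique.map⁺ (∷ʳ-injectiveˡ _ _) (goodArrangements-unique f lo-even)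
... | odd t  = Unique.++⁺ (Unique.map⁺ ∷-injectiveʳ (goodArrangements-unique f lo-even))
                          (Unique-concatMap⁺ (Unique.upTo⁺ (suc t)) split-unique split-apart)
                          head-split-apart
  where
  M = lo + suc (suc (double t))
  M∉upper : ∀ {s α} → suc s ≤ t → α ∈ goodArrangements f j (lo + double (suc s)) (suc (double (t ∸ suc s))) →
            M ∉ α
  M∉upper {s} s<t α∈ M∈α = <-irrefl refl (All.lookup (upper-block-<max {m = double (suc s)} (split-length s<t) α-arr) M∈α)
    where α-arr = proj₁ (sound f (isEven-+-double lo (suc s) lo-even) α∈)
  split-unique : ∀ {s} → s ∈ upTo (suc t) → Unique (goodSplits f j lo t s)
  split-unique {zero}  _  = []
  split-unique {suc s} s∈ =
    Unique-cartesianProductWith⁺-on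
      (λ α∈ α′∈ _ _ → ++-∷-cancel _ _ (M∉upper s<t α∈) (M∉upper s<t α′∈))
      (goodArrangements-unique f (isEven-+-double lo (suc s) lo-even)) (goodArrangements-unique f lo-even)
    where s<t = ≤-pred (∈-upTo⁻ s∈)
  split-apart : ∀ {s s′ z} → s ∈ upTo (suc t) → s′ ∈ upTo (suc t) →
                z ∈ goodSplits f j lo t s → z ∈ goodSplits f j lo t s′ → s ≡ s′
  split-apart {zero}  _  _   ()
  split-apart {suc s} {zero} _ _ _ ()
  split-apart {suc s} {suc s′} s∈ s′∈ z∈ z∈′
    with ∈-cartesianProductWith⁻ _ (goodArrangements f j _ _) (goodArrangements f (suc j) _ _) z∈
       | ∈-cartesianProductWith⁻ _ (goodArrangements f j _ _) (goodArrangements f (suc j) _ _) z∈′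
  ... | α , β , α∈ , β∈ , refl | α′ , β′ , α′∈ , β′∈ , eq
    with ++-∷-cancel α α′ (M∉upper (≤-pred (∈-upTo⁻ s∈)) α∈) (M∉upper (≤-pred (∈-upTo⁻ s′∈)) α′∈) eq
  ...   | _ , refl = cong suc (double-injective (suc-injective (suc-injective
                       (trans (sym (length≡ (proj₁ (sound f lo-even β∈)))) (length≡ (proj₁ (sound f lo-even β′∈)))))))
  head-split-apart : ∀ {z} → ¬ (z ∈ map (M ∷_) (goodArrangements f (suc j) lo (suc (double t))) ×
                                z ∈ concatMap (goodSplits f j lo t) (upTo (suc t)))
  head-split-apart (z∈heads , z∈splits)
    with ∈-map⁻ (M ∷_) z∈heads | find (∈-concatMap⁻ (goodSplits f j lo t) {upTo (suc t)} z∈splits)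
  ... | _ | zero , _ , ()
  ... | β₀ , _ , refl | suc s , s∈ , z∈split
    with ∈-cartesianProductWith⁻ _ (goodArrangements f j _ _) (goodArrangements f (suc j) _ _) z∈split
  ... | α , β , α∈ , _ , eq with ++-∷-cancel [] α (λ ()) (M∉upper (≤-pred (∈-upTo⁻ s∈)) α∈) eq
  ...   | refl , _ with length≡ (proj₁ (sound f (isEven-+-double lo (suc s) lo-even) α∈))
  ...     | ()

length-goodArrangements : ∀ f {j lo len} → len < f → length (goodArrangements f j lo len) ≡ 𝒟 j len
length-goodArrangements (suc f) {j} {len = zero}             _ = sym (𝒟-zero j)
length-goodArrangements (suc f) {zero} {len = suc zero}      _ = refl
length-goodArrangements (suc f) {zero} {len = suc (suc n)}   _ = sym (𝒟₀-suc-suc n)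
length-goodArrangements (suc f) {suc j} {lo} {suc n} (s≤s n<f) with parity n
... | even t = begin
  length (map _ (goodArrangements f j lo (double t))) ≡⟨ length-map _ (goodArrangements f j lo (double t)) ⟩
  length (goodArrangements f j lo (double t))         ≡⟨ length-goodArrangements f n<f ⟩
  𝒟 j (double t)                                      ≡⟨ 𝒟-suc-odd j t ⟨
  𝒟 (suc j) (suc (double t))                          ∎
  where open ≡-Reasoning
... | odd t  = begin
  length (map (M ∷_) heads ++ concatMap (goodSplits f j lo t) (upTo (suc t)))
    ≡⟨ length-++ (map (M ∷_) heads) ⟩
  length (map (M ∷_) heads) + length (concatMap (goodSplits f j lo t) (upTo (suc t)))
    ≡⟨ cong₂ _+_ (trans (length-map (M ∷_) heads) (length-goodArrangements f n<f))
                 (length-concatMap-applyUpTo (goodSplits f j lo t) (λ i → i) t) ⟩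
  𝒟 (suc j) (suc (double t)) + sumTo t (length ∘ goodSplits f j lo t)
    ≡⟨ cong (𝒟 (suc j) (suc (double t)) +_) (sumTo-cong t length-split) ⟩
  𝒟 (suc j) (suc (double t)) + sumTo t (splitCount j t)
    ≡⟨ 𝒟-suc-even j t ⟨
  𝒟 (suc j) (double (suc t))
    ∎
  where
  open ≡-Reasoning
  M = lo + suc (suc (double t))
  heads = goodArrangements f (suc j) lo (suc (double t))
  length-split : ∀ s → s ≤ t → length (goodSplits f j lo t s) ≡ splitCount j t s
  length-split zero    _   = refl
  length-split (suc s) s<t =
    trans (length-cartesianProductWith _ (goodArrangements f j _ _) (goodArrangements f (suc j) _ _))
          (cong₂ _*_ (length-goodArrangements f (≤-<-trans (m≤m+n _ (double (suc s))) split<f))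
                     (length-goodArrangements f (≤-<-trans (m≤n+m _ (suc (double (t ∸ suc s)))) split<f)))
    where
    split<f : suc (double (t ∸ suc s)) + double (suc s) < f
    split<f = subst (_< f) (sym (split-length s<t)) n<f

good⇔Good : ∀ j π → T (dumont π ∧ avoids π p132 ∧ avoids π (p213k (suc (suc j)))) ⇔ Good j π
good⇔Good j π = mk⇔ to from
  where
  avoid132 = avoids⇔¬Occurs {π} {p132} orderIso-132
  avoid213k = avoids⇔¬Occurs {π} {p213k (suc (suc j))} (orderIso-213k j)
  to : T (dumont π ∧ avoids π p132 ∧ avoids π (p213k (suc (suc j)))) → Good j π
  to t = let dπ , avoids-both = T-∧⁻ t ; av132 , av213k = T-∧⁻ avoids-both
         in dπ , Equivalence.to avoid132 av132 , Equivalence.to avoid213k av213k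
  from : Good j π → T (dumont π ∧ avoids π p132 ∧ avoids π (p213k (suc (suc j))))
  from (dπ , ¬132 , ¬213k) = T-∧⁺ dπ (T-∧⁺ (Equivalence.from avoid132 ¬132) (Equivalence.from avoid213k ¬213k))

D≡length-goodArrangements : ∀ j n → D (p213k (suc (suc j))) n ≡ length (goodArrangements (suc n) j 0 n)
D≡length-goodArrangements j n =
  Unique-length-≡ (Unique.filter⁺ P? (perms-unique n)) (goodArrangements-unique (suc n) {j} {0} {n} tt) to from
  where
  P? = λ π → T? (dumont π ∧ avoids π p132 ∧ avoids π (p213k (suc (suc j))))
  to : ∀ {π} → π ∈ filter P? (perms n) → π ∈ goodArrangements (suc n) j 0 n
  to π∈ = let π∈perms , good = ∈-filter⁻ P? π∈
          in complete (suc n) tt ≤-refl (Equivalence.to (∈-perms⇔ {n}) π∈perms) (Equivalence.to (good⇔Good j _) good)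
  from : ∀ {π} → π ∈ goodArrangements (suc n) j 0 n → π ∈ filter P? (perms n)
  from π∈ = let arr , good = sound (suc n) tt π∈
            in ∈-filter⁺ P? (Equivalence.from (∈-perms⇔ {n}) arr) (Equivalence.from (good⇔Good j _) good)

theorem2p8 : (k : ℕ) → 2 ≤ k → (n : ℕ) → D (p213k k) n ≡ (G (k ∸ 1) ⊕ X ⊛ G (k ∸ 2)) n
theorem2p8 (suc zero) (s≤s ()) n
theorem2p8 (suc (suc j)) _ n = begin
  D (p213k (suc (suc j))) n                ≡⟨ D≡length-goodArrangements j n ⟩
  length (goodArrangements (suc n) j 0 n)  ≡⟨ length-goodArrangements (suc n) ≤-refl ⟩
  𝒟 j n                                    ∎
  where open ≡-Reasoning
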